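{- Let $k\ge 2$ and $n\ge 1$ be integers, and consider labeled chip-firing on the infinite rooted directed $k$-ary tree starting with chips $1,\dots,k^n$ at the root. For every traversal string $t=t_1\cdots t_i$ with $1\le i\le n$ and every $1\le x\le k^{n-i}$, every integer $c$ with $a(t,x)\le c\le b(t,x)$ can land at the landing order $(t,x)$. In particular, for a traversal string $t$ of length $n$, the set of chips that can end at the vertex $v_t$ of layer $n+1$ in a stable configuration is exactly the set of integers from $a(t,1)=\prod_{j=1}^n t_j$ to $b(t,1)=k^n+1-\prod_{j=1}^n (k+1-t_j)$, inclusive.
   Context: The infinite rooted directed $k$-ary tree: every vertex has exactly $k$ children, ordered from leftmost (1st) to rightmost ($k$th), with edges directed from parent to child. The root is on layer 1, and children of a vertex on layer $\ell$ are on layer $\ell+1$. A traversal string is a finite string $t=t_1t_2\cdots t_i$ with each $t_\ell\in\{1,\dots,k\}$; it determines the vertex $v_t$ reached from the root by moving, at step $\ell$, to the $t_\ell$-th leftmost child; $v_t$ lies on layer $i+1$. Labeled chip-firing: initially $k^n$ chips labeled $1,\dots,k^n$ are on the root. A vertex holding at least $k$ chips may fire: one chooses any $k$ of its chips and sends the chip with the $r$-th smallest label to the $r$-th leftmost child, for $r=1,\dots,k$. The game continues until no vertex can fire (a stable configuration); a firing strategy is any sequence of such choices. For every strategy, exactly $k^{n-i}$ chips arrive at each vertex of layer $i+1$ ($0\le i\le n$) during the game, and in the stable configuration each vertex of layer $n+1$ holds exactly one chip. For a traversal string $t$ of length $i\le n$ and $1\le x\le k^{n-i}$, the pair $(t,x)$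 is called a landing order (on layer $i+1$); under a given strategy, the chip at $(t,x)$ is the $x$-th smallest (by label) of the $k^{n-i}$ chips that arrive at $v_t$. A chip $c$ can land at $(t,x)$ if some firing strategy puts $c$ at $(t,x)$. $a(t,x)$ and $b(t,x)$ denote the smallest and largest labels of chips that can land at $(t,x)$. For $t$ of length $n$, the chip at $(t,1)$ is the chip on $v_t$ in the stable configuration. -}

module Defs where

open import Data.Nat using (ℕ; zero; suc; _+_; _*_; _∸_; _^_; _≤_; _<_)
open import Data.Fin using (Fin; toℕ; _≟_) renaming (_<_ to _<ᶠ_; _<?_ to _<ᶠ?_)
open import Data.List using (List; []; _∷_; _++_; [_]; length; filter; foldr; map)
open import Data.List.Relation.Binary.Prefix.Heterogeneous using (Prefix)
open import Data.List.Relation.Binary.Prefix.Heterogeneous.Properties using (prefix?)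
open import Data.Product using (Σ; _×_; ∃; ∃-syntax)
open import Data.Fin.Base using () 
open import Data.List using (allFin)
open import Relation.Binary.PropositionalEquality using (_≡_; _≢_)
open import Relation.Binary.Construct.Closure.ReflexiveTransitive using (Star)
open import Relation.Nullary using (¬_)
open import Relation.Nullary.Decidable using (_×-dec_)

-- A vertex of the infinite k-ary tree is identified with its traversal string
-- (root = []). Child index r : Fin k stands for the (toℕ r + 1)-th leftmost child.
Vertex : ℕ → Set
Vertex k = List (Fin k)

-- Chips: chip d : Fin (k ^ n) carries label toℕ d + 1 ∈ {1, …, k^n};
-- the order on Fin agrees with the order on labels.
Chip : ℕ → ℕ → Set
Chip k n = Fin (k ^ n)

Config : ℕ → ℕ → Set
Config k n = Chip k n → Vertex k

initial : (k n : ℕ) → Config k n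
initial k n _ = []

Fire : (k n : ℕ) → Config k n → Config k n → Set
Fire k n f f′ =
  Σ (Vertex k) λ v → Σ (Fin k → Chip k n) λ g →
    (∀ r s → r <ᶠ s → g r <ᶠ g s)
    × (∀ r → f (g r) ≡ v)
    × (∀ r → f′ (g r) ≡ v ++ [ r ])
    × (∀ d → (∀ r → d ≢ g r) → f′ d ≡ f d)

Reachable : (k n : ℕ) → Config k n → Config k n → Set
Reachable k n = Star (Fire k n)

Stable : (k n : ℕ) → Config k n → Set
Stable k n f = ¬ (∃[ f′ ] Fire k n f f′)

-- The chips arriving at v_t during a complete game ending in f are exactly
-- the chips whose final vertex lies in the subtree of v_t (t is a prefix).
ArrivesAt : (k n : ℕ) → Config k n → Vertex k → Chip k n → Set
ArrivesAt k n f t d = Prefix _≡_ t (f d)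

countBelow : (k n : ℕ) → Config k n → Vertex k → Chip k n → ℕ
countBelow k n f t d =
  length (filter (λ e → (e <ᶠ? d) ×-dec prefix? _≟_ t (f e)) (allFin (k ^ n)))

AtLandingOrder : (k n : ℕ) → Config k n → Vertex k → ℕ → Chip k n → Set
AtLandingOrder k n f t x d = ArrivesAt k n f t d × suc (countBelow k n f t d) ≡ x

CanLand : (k n : ℕ) → Vertex k → ℕ → ℕ → Set
CanLand k n t x c =
  Σ (Chip k n) λ d → (suc (toℕ d) ≡ c) ×
    Σ (Config k n) λ f → Reachable k n (initial k n) f × Stable k n f × AtLandingOrder k n f t x d

IsA : (k n : ℕ) → Vertex k → ℕ → ℕ → Set
IsA k n t x a = CanLand k n t x a × (∀ c → CanLand k n t x c → a ≤ c)

IsB : (k n : ℕ) → Vertex k → ℕ → ℕ → Set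
IsB k n t x b = CanLand k n t x b × (∀ c → CanLand k n t x c → c ≤ b)

CanEndAt : (k n : ℕ) → Vertex k → ℕ → Set
CanEndAt k n t c =
  Σ (Chip k n) λ d → (suc (toℕ d) ≡ c) ×
    Σ (Config k n) λ f → Reachable k n (initial k n) f × Stable k n f × f d ≡ t

-- ∏_j t_j  and  ∏_j (k + 1 - t_j), with t_j = toℕ (entry) + 1
prodT : {k : ℕ} → Vertex k → ℕ
prodT t = foldr _*_ 1 (map (λ r → suc (toℕ r)) t)

prodK : (k : ℕ) → Vertex k → ℕ
prodK k t = foldr _*_ 1 (map (λ r → k ∸ toℕ r) t)

-- A set q of chips closed downwards in label gains a chip at child s of a firing vertex only if it
-- also gains one at every child left of s. So the subtree of a left child always holds at least as
-- many chips of q as that of a right sibling, and along the path to v_t the number of q-chips below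
-- the current vertex shrinks by a factor of at least t_j per step. With q = {labels ≤ c} (and
-- symmetrically q = {labels ≥ c}) this gives ∏ t_j ≤ c ≤ k^n + 1 − ∏ (k + 1 − t_j) for every chip c
-- reaching v_t; with q = all chips it shows that a stable configuration has one chip on every leaf.
--
-- If chips c and c + 1 end on leaves with c + 1 left of c, swapping their labels throughout a complete
-- game gives another complete game, and the label at any landing order changes by at most one. Such
-- swaps increase Σ_c c · rank (leaf of c), so repeating them reaches the sorted game, passing through
-- every label between the initial one and the sorted one; two games with labels a ≤ b at (t , x)
-- therefore cover [a , b].
--
-- Finally, dealing the chips of each vertex round-robin, the lowest t_j·K of them to the first t_j
-- children, realises ∏ t_j, and the symmetric dealing realises k^n + 1 − ∏ (k + 1 − t_j).

module Submission where

open import Defs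

open import Data.Bool using (Bool; true; false; _∧_; if_then_else_)
open import Data.Bool.Properties using (∧-identityʳ; ∧-zeroʳ; ∧-conicalˡ; ∧-conicalʳ)
open import Data.Empty using (⊥-elim)
open import Data.Fin as Fin using (Fin; zero; suc; toℕ; fromℕ<; inject₁) renaming (_<_ to _<ᶠ_)
open import Data.Fin.Permutation using (Permutation′; _⟨$⟩ʳ_; _⟨$⟩ˡ_; inverseˡ; inverseʳ; transpose; flip)
import Data.Fin.Permutation.Components as PC
open import Data.Fin.Properties using (toℕ<n; toℕ-injective; toℕ-fromℕ<; fromℕ<-toℕ; toℕ-inject₁; any?)
  renaming (suc-injective to sucᶠ-injective; _≟_ to _≟ᶠ_; _<?_ to _<ᶠ?_; _≤?_ to _≤ᶠ?_)
open import Data.List using (List; []; _∷_; length; _++_; [_]; _∷ʳ_; filter; tabulate; map; foldr; take; drop)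
open import Data.List.Properties
  using (≡-dec; ∷-injective; ∷ʳ-injective; ++-assoc; ++-identityʳ; length-++; length-map; length-take; length-drop; take++drop≡id)
open import Data.List.Relation.Binary.Pointwise as Pointwise using (Pointwise-≡⇒≡)
open import Data.List.Relation.Binary.Prefix.Heterogeneous as Prefix using (Prefix; []; _∷_; _++ᵖ_; toView)
open import Data.List.Relation.Binary.Prefix.Heterogeneous.Properties using (fromPointwise; toPointwise; length-mono; prefix?)
open import Data.Nat
open import Data.Nat.DivMod using (_/_; _%_; m≡m%n+[m/n]*n; m%n<n)
open import Data.Nat.Induction using (<-wellFounded)
open import Data.Nat.Properties
open import Algebra.Properties.Semiring.Sum +-*-semiring
  using (sum; sum-cong-≗; ∑-comm; ∑-distrib-+; *-distribˡ-sum; *-distribʳ-sum; ∑-permute)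
open import Data.Nat.Tactic.RingSolver using (solve-∀)
open import Data.Product using (Σ-syntax; ∃; _×_; _,_; proj₁; proj₂)
open import Data.Sum using (_⊎_; inj₁; inj₂)
open import Function using (_∘_; _⇔_; mk⇔)
open import Induction.WellFounded using (Acc; acc)
open import Relation.Binary.Construct.Closure.ReflexiveTransitive using (Star; ε; _◅_; _◅◅_)
open import Relation.Binary.Definitions using (tri<; tri≈; tri>)
open import Relation.Binary.PropositionalEquality hiding ([_])
open import Relation.Nullary using (Dec; yes; no; does; ¬_; contradiction)
open import Relation.Nullary.Decidable using (dec-true; dec-false; does-⇔; _×-dec_)
open import Relation.Unary using (Pred; Decidable)

m*n+o<[1+m]*n : ∀ m n {o} → o < n → m * n + o < suc m * n
m*n+o<[1+m]*n m n {o} o<n = subst (m * n + o <_) (+-comm (m * n) n) (+-monoʳ-< (m * n) o<n)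

quotient-unique : ∀ a b r K → r < K → b * K ≤ a * K + r → a * K + r < suc b * K → a ≡ b
quotient-unique a b r K r<K lower upper = ≤-antisym
  (m<1+n⇒m≤n (*-cancelʳ-< K a (suc b) (≤-<-trans (m≤m+n (a * K) r) upper)))
  (m<1+n⇒m≤n (*-cancelʳ-< K b (suc a) (≤-<-trans lower (m*n+o<[1+m]*n a K r<K))))

divmod-unique : ∀ {q₁ q₂ r₁ r₂} K → r₁ < K → r₂ < K → q₁ * K + r₁ ≡ q₂ * K + r₂ → q₁ ≡ q₂ × r₁ ≡ r₂
divmod-unique {q₁} {q₂} {r₁} {r₂} K r₁<K r₂<K eq = q₁≡q₂ , +-cancelˡ-≡ (q₁ * K) r₁ r₂ (trans eq (cong (λ q → q * K + r₂) (sym q₁≡q₂)))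
  where
  q₁≡q₂ : q₁ ≡ q₂
  q₁≡q₂ = quotient-unique q₁ q₂ r₁ K r₁<K (subst (q₂ * K ≤_) (sym eq) (m≤m+n (q₂ * K) r₂))
                          (subst (_< suc q₂ * K) (sym eq) (m*n+o<[1+m]*n q₂ K r₂<K))

increasing-bounded⇒id : ∀ N (g : ℕ → ℕ) → (∀ i → suc i < N → g i < g (suc i)) → (∀ i → i < N → g i < N) →
                        ∀ i → i < N → g i ≡ i
increasing-bounded⇒id N g increasing bounded i i<N = ≤-antisym (m<1+n⇒m≤n g-upper) (lower i i<N)
  where
  lower : ∀ i → i < N → i ≤ g i
  lower zero    _    = z≤n
  lower (suc i) i<N = ≤-trans (s≤s (lower i (<-trans (n<1+n i) i<N))) (increasing i i<N)
  headroom : ∀ j i → i + j < N → g i + j < N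
  headroom zero    i i<N = subst (_< N) (sym (+-identityʳ (g i))) (bounded i (subst (_< N) (+-identityʳ i) i<N))
  headroom (suc j) i i+j<N =
    ≤-<-trans (subst (_≤ g (suc i) + j) (sym (+-suc (g i) j)) (+-monoˡ-≤ j (increasing i (≤-<-trans (m≤m+n (suc i) j) i+1+j<N))))
              (headroom j (suc i) i+1+j<N)
    where
    i+1+j<N : suc i + j < N
    i+1+j<N = subst (_< N) (+-suc i j) i+j<N
  g-upper : g i < suc i
  g-upper = +-cancelʳ-< (N ∸ suc i) (g i) (suc i)
    (subst (g i + (N ∸ suc i) <_) (sym (m+[n∸m]≡n i<N))
      (headroom (N ∸ suc i) i (subst (i + (N ∸ suc i) <_) (m+[n∸m]≡n i<N) (n<1+n _))))

rearrangement : ∀ c {a b} → b < a → c * a + suc c * b < c * b + suc c * a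
rearrangement c {a} {b} b<a = begin-strict
  c * a + suc c * b      ≡⟨ regroup c a b ⟩
  (c * a + c * b) + b    <⟨ +-monoʳ-< (c * a + c * b) b<a ⟩
  (c * a + c * b) + a    ≡⟨ regroup′ c a b ⟨
  c * b + suc c * a      ∎
  where
  open ≤-Reasoning
  regroup : ∀ c a b → c * a + suc c * b ≡ (c * a + c * b) + b
  regroup = solve-∀
  regroup′ : ∀ c a b → c * b + suc c * a ≡ (c * a + c * b) + a
  regroup′ = solve-∀

quot rem : ℕ → ℕ → ℕ
quot i zero    = 0
quot i (suc u) = i / suc u
rem  i zero    = 0
rem  i (suc u) = i % suc u

quot-rem : ∀ i {u} → 0 < u → i ≡ quot i u * u + rem i u
quot-rem i {suc u} _ = trans (m≡m%n+[m/n]*n i (suc u)) (+-comm (i % suc u) _)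

rem< : ∀ i {u} → 0 < u → rem i u < u
rem< i {suc u} _ = m%n<n i (suc u)

quot-rem-of : ∀ j {r u} → r < u → quot (j * u + r) u ≡ j × rem (j * u + r) u ≡ r
quot-rem-of j {r} {u} r<u = divmod-unique u (rem< (j * u + r) 0<u) r<u (sym (quot-rem (j * u + r) 0<u))
  where
  0<u : 0 < u
  0<u = ≤-<-trans z≤n r<u

factor-positive : ∀ {i} K u → i < K * u → 0 < u
factor-positive {i} K zero    i<K*0 = ⊥-elim (<⇒≱ i<K*0 (subst (_≤ i) (sym (*-zeroʳ K)) z≤n))
factor-positive     K (suc u) _     = s≤s z≤n

quot< : ∀ i u K → i < K * u → quot i u < K
quot< i u K i<Ku = *-cancelʳ-< u (quot i u) K
  (≤-<-trans (≤-trans (m≤m+n _ (rem i u)) (≤-reflexive (sym (quot-rem i (factor-positive K u i<Ku))))) i<Ku)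

radix< : ∀ {j r} K u → j < K → r < u → j * u + r < K * u
radix< {j} K u j<K r<u = <-≤-trans (m*n+o<[1+m]*n j u r<u) (*-monoˡ-≤ u j<K)

radix-mono : ∀ {j j′ r} s u → j < j′ → r < u → j * u + r < j′ * u + s
radix-mono {j′ = j′} s u j<j′ r<u = <-≤-trans (radix< j′ u j<j′ r<u) (m≤m+n (j′ * u) s)

sum-mono-≤ : ∀ {m} {f g : Fin m → ℕ} → (∀ i → f i ≤ g i) → sum f ≤ sum g
sum-mono-≤ {zero}  le = z≤n
sum-mono-≤ {suc m} le = +-mono-≤ (le zero) (sum-mono-≤ (le ∘ suc))

lookup≤sum : ∀ {m} (f : Fin m → ℕ) i → f i ≤ sum f
lookup≤sum f zero    = m≤m+n _ _
lookup≤sum f (suc i) = ≤-trans (lookup≤sum (f ∘ suc) i) (m≤n+m _ (f zero))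

sum-zero : ∀ {m} {f : Fin m → ℕ} → (∀ i → f i ≡ 0) → sum f ≡ 0
sum-zero {zero}  f≡0 = refl
sum-zero {suc m} f≡0 = cong₂ _+_ (f≡0 zero) (sum-zero (f≡0 ∘ suc))

sum-const : ∀ m c → sum {m} (λ _ → c) ≡ m * c
sum-const zero    c = refl
sum-const (suc m) c = cong (c +_) (sum-const m c)

-- Both sides are moved so that no subtraction occurs.
sum-update : ∀ {m} {f g : Fin m → ℕ} i → (∀ j → j ≢ i → f j ≡ g j) → sum f + g i ≡ sum g + f i
sum-update {suc m} {f} {g} zero f≡g
  rewrite sum-cong-≗ {x = f ∘ suc} {g ∘ suc} (λ j → f≡g (suc j) λ ()) =
    trans (+-assoc (f zero) _ _) (trans (+-comm (f zero) _)
      (cong (_+ f zero) (+-comm (sum (g ∘ suc)) (g zero))))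
sum-update {suc m} {f} {g} (suc i) f≡g rewrite f≡g zero (λ ()) =
  trans (+-assoc (g zero) _ _) (trans
    (cong (g zero +_) (sum-update i (λ j j≢i → f≡g (suc j) (j≢i ∘ sucᶠ-injective))))
    (sym (+-assoc (g zero) _ _)))

sum-single : ∀ {m} {f : Fin m → ℕ} i → (∀ j → j ≢ i → f j ≡ 0) → sum f ≡ f i
sum-single {m} {f} i f≡0 =
  trans (sym (+-identityʳ (sum f))) (trans (sum-update {f = f} {g = λ _ → 0} i f≡0) (cong (_+ f i) (sum-zero {m} (λ _ → refl))))

sum-update₂ : ∀ {m} {f g : Fin m → ℕ} i j → i ≢ j → (∀ e → e ≢ i → e ≢ j → f e ≡ g e) →
              sum f + (g i + g j) ≡ sum g + (f i + f j)
sum-update₂ {m} {f} {g} i j i≢j f≡g = begin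
  sum f + (g i + g j)   ≡⟨ sym (+-assoc (sum f) (g i) (g j)) ⟩
  sum f + g i + g j     ≡⟨ cong (λ z → sum f + z + g j) (sym (h≡g i (i≢j))) ⟩
  sum f + h i + g j     ≡⟨ cong (_+ g j) (sum-update {g = h} i (λ e e≢i → sym (h-other e e≢i))) ⟩
  sum h + f i + g j     ≡⟨ +-assoc (sum h) (f i) (g j) ⟩
  sum h + (f i + g j)   ≡⟨ cong (sum h +_) (+-comm (f i) (g j)) ⟩
  sum h + (g j + f i)   ≡⟨ sym (+-assoc (sum h) (g j) (f i)) ⟩
  sum h + g j + f i     ≡⟨ cong (_+ f i) (sum-update {f = h} j h≡g) ⟩
  sum g + h j + f i     ≡⟨ cong (λ z → sum g + z + f i) (h-other j (i≢j ∘ sym)) ⟩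
  sum g + f j + f i     ≡⟨ +-assoc (sum g) (f j) (f i) ⟩
  sum g + (f j + f i)   ≡⟨ cong (sum g +_) (+-comm (f j) (f i)) ⟩
  sum g + (f i + f j)   ∎
  where
  open ≡-Reasoning
  h : Fin m → ℕ
  h e = if does (e ≟ᶠ i) then g e else f e
  h-other : ∀ e → e ≢ i → h e ≡ f e
  h-other e e≢i rewrite dec-false (e ≟ᶠ i) e≢i = refl
  h≡g : ∀ e → e ≢ j → h e ≡ g e
  h≡g e e≢j with e ≟ᶠ i
  ... | yes _   = refl
  ... | no e≢i = f≡g e e≢i e≢j

does-true⇒ : ∀ {a} {A : Set a} (a? : Dec A) → does a? ≡ true → A
does-true⇒ (yes a) _ = a

module _ {a p} {A : Set a} {P : Set p} {x y : A} where

  if-yes : (p? : Dec P) → P → (if does p? then x else y) ≡ x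
  if-yes p? p = cong (if_then x else y) (dec-true p? p)

  if-no : (p? : Dec P) → ¬ P → (if does p? then x else y) ≡ y
  if-no p? ¬p = cong (if_then x else y) (dec-false p? ¬p)

  if-⇔ : ∀ {q} {Q : Set q} → P ⇔ Q → (p? : Dec P) (q? : Dec Q) → (if does p? then x else y) ≡ (if does q? then x else y)
  if-⇔ P⇔Q p? q? = cong (if_then x else y) (does-⇔ P⇔Q p? q?)

indicator : Bool → ℕ
indicator b = if b then 1 else 0

count : ∀ {m} → (Fin m → Bool) → ℕ
count p = sum (indicator ∘ p)

count-≥1 : ∀ {m} (p : Fin m → Bool) i → p i ≡ true → 1 ≤ count p
count-≥1 p i pi = subst (_≤ count p) (cong indicator pi) (lookup≤sum (indicator ∘ p) i)

count-≥2 : ∀ {m} (p : Fin m → Bool) i j → i ≢ j → p i ≡ true → p j ≡ true → 2 ≤ count p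
count-≥2 p zero    zero    i≢j _  _  = ⊥-elim (i≢j refl)
count-≥2 p zero    (suc j) _   pi pj rewrite pi = s≤s (count-≥1 (p ∘ suc) j pj)
count-≥2 p (suc i) zero    _   pi pj rewrite pj = s≤s (count-≥1 (p ∘ suc) i pi)
count-≥2 p (suc i) (suc j) i≢j pi pj =
  ≤-trans (count-≥2 (p ∘ suc) i j (i≢j ∘ cong suc) pi pj) (m≤n+m _ (indicator (p zero)))

count-none : ∀ {m} (p : Fin m → Bool) → (∀ i → p i ≡ false) → count p ≡ 0
count-none p p≡false = sum-zero (cong indicator ∘ p≡false)

count-≤1 : ∀ {m} (p : Fin m → Bool) → (∀ i j → p i ≡ true → p j ≡ true → i ≡ j) → count p ≤ 1
count-≤1 {zero}  p unique = z≤n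
count-≤1 {suc m} p unique with p zero in p0
... | false = count-≤1 (p ∘ suc) (λ i j pi pj → sucᶠ-injective (unique (suc i) (suc j) pi pj))
... | true  = ≤-reflexive (cong suc (count-none (p ∘ suc) others))
  where
  others : ∀ i → p (suc i) ≡ false
  others i with p (suc i) in pi
  ... | false = refl
  ... | true  = contradiction (unique zero (suc i) p0 pi) λ ()

indicator-∧ : ∀ a b → indicator a * indicator b ≡ indicator (a ∧ b)
indicator-∧ false b     = refl
indicator-∧ true  false = refl
indicator-∧ true  true  = refl

indicator-mono : ∀ {a b} → (a ≡ true → b ≡ true) → indicator a ≤ indicator b
indicator-mono {false}         _   = z≤n
indicator-mono {true}  {true}  _   = ≤-refl
indicator-mono {true}  {false} a⇒b with () ← a⇒b refl

count-≤-indicator : ∀ {m} (p : Fin m → Bool) b → (∀ i → p i ≡ true → b ≡ true) →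
                    (∀ i j → p i ≡ true → p j ≡ true → i ≡ j) → count p ≤ indicator b
count-≤-indicator p true  _    unique = count-≤1 p unique
count-≤-indicator p false p⇒b  _      = ≤-reflexive (count-none p none)
  where
  none : ∀ i → p i ≡ false
  none i with p i in pi
  ... | false = refl
  ... | true  with () ← p⇒b i pi

count-all : ∀ {m} (p : Fin m → Bool) → (∀ i → p i ≡ true) → count p ≡ m
count-all {zero}  p all = refl
count-all {suc m} p all rewrite all zero = cong suc (count-all (p ∘ suc) (all ∘ suc))

count-cong : ∀ {m} {p q : Fin m → Bool} → (∀ i → p i ≡ q i) → count p ≡ count q
count-cong p≡q = sum-cong-≗ (cong indicator ∘ p≡q)

count-< : ∀ {m} (d : Fin m) → count {m} (λ e → does (e <ᶠ? d)) ≡ toℕ d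
count-< {suc m} zero    = count-none _ (λ (e : Fin m) → dec-false (suc e <ᶠ? zero {m}) λ ())
count-< {suc m} (suc d) = cong suc (trans
  (count-cong (λ (e : Fin m) → does-⇔ (mk⇔ ≤-pred s≤s) (suc e <ᶠ? suc d) (e <ᶠ? d))) (count-< d))

count-≤ : ∀ {m} (d : Fin m) → count {m} (λ e → does (e ≤ᶠ? d)) ≡ suc (toℕ d)
count-≤ {suc m} zero    = cong suc (count-none _ (λ (e : Fin m) → dec-false (suc e ≤ᶠ? zero {m}) λ ()))
count-≤ {suc m} (suc d) = cong suc (trans
  (count-cong (λ (e : Fin m) → does-⇔ (mk⇔ ≤-pred s≤s) (suc e ≤ᶠ? suc d) (e ≤ᶠ? d))) (count-≤ d))

count-≥ : ∀ {m} (d : Fin m) → count {m} (λ e → does (d ≤ᶠ? e)) ≡ m ∸ toℕ d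
count-≥ {suc m} zero    = count-all _ (λ _ → refl)
count-≥ {suc m} (suc d) = trans
  (count-cong (λ (e : Fin m) → does-⇔ (mk⇔ ≤-pred s≤s) (suc d ≤ᶠ? suc e) (d ≤ᶠ? e))) (count-≥ d)

count-interval : ∀ {m} (d : Fin m) a → count {m} (λ e → does (e <ᶠ? d) ∧ does (a ≤? toℕ e)) ≡ toℕ d ∸ a
count-interval {suc m} zero    a       = trans
  (count-none (λ (e : Fin (suc m)) → does (e <ᶠ? zero {m}) ∧ does (a ≤? toℕ e))
              (λ e → cong (_∧ does (a ≤? toℕ e)) (dec-false (e <ᶠ? zero {m}) λ ())))
  (sym (0∸n≡0 a))
count-interval {suc m} (suc d) zero    = cong suc (trans (count-cong λ (e : Fin m) →
  cong₂ _∧_ (does-⇔ (mk⇔ ≤-pred s≤s) (suc e <ᶠ? suc d) (e <ᶠ? d)) (does-⇔ (mk⇔ (λ _ → z≤n) (λ _ → z≤n)) (0 ≤? suc (toℕ e)) (0 ≤? toℕ e)))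
  (count-interval d zero))
count-interval {suc m} (suc d) (suc a) = trans (count-cong λ (e : Fin m) →
  cong₂ _∧_ (does-⇔ (mk⇔ ≤-pred s≤s) (suc e <ᶠ? suc d) (e <ᶠ? d)) (does-⇔ (mk⇔ ≤-pred s≤s) (suc a ≤? suc (toℕ e)) (a ≤? toℕ e)))
  (count-interval d a)

length-filter-tabulate : ∀ {a p} {A : Set a} {P : Pred A p} (P? : Decidable P) {m} (f : Fin m → A) →
                         length (filter P? (tabulate f)) ≡ count (does ∘ P? ∘ f)
length-filter-tabulate P? {zero}  f = refl
length-filter-tabulate P? {suc m} f with does (P? (f zero))
... | false = length-filter-tabulate P? (f ∘ suc)
... | true  = cong suc (length-filter-tabulate P? (f ∘ suc))

StrictlyIncreasing : ∀ {j m} → (Fin j → Fin m) → Set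
StrictlyIncreasing g = ∀ r s → r <ᶠ s → g r <ᶠ g s

increasing⇒injective : ∀ {j m} {g : Fin j → Fin m} → StrictlyIncreasing g → ∀ r s → g r ≡ g s → r ≡ s
increasing⇒injective g-inc r s gr≡gs with <-cmp (toℕ r) (toℕ s)
... | tri< r<s _ _ = ⊥-elim (<-irrefl (cong toℕ gr≡gs) (g-inc r s r<s))
... | tri≈ _ r≡s _ = toℕ-injective r≡s
... | tri> _ _ s<r = ⊥-elim (<-irrefl (cong toℕ (sym gr≡gs)) (g-inc s r s<r))

increasing-witnesses : ∀ {m} (p : Fin m → Bool) j → j ≤ count p →
                       Σ[ g ∈ (Fin j → Fin m) ] StrictlyIncreasing g × (∀ r → p (g r) ≡ true)
increasing-witnesses p zero _ = (λ ()) , (λ ()) , (λ ())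
increasing-witnesses {suc m} p (suc j) j≤count with p zero in p0
... | false = let g , g-inc , pg = increasing-witnesses (p ∘ suc) (suc j) j≤count in
  suc ∘ g , (λ r s r<s → s≤s (g-inc r s r<s)) , pg
... | true  = let g , g-inc , pg = increasing-witnesses (p ∘ suc) j (≤-pred j≤count) in
  cons g , cons-inc g-inc , cons-p pg
  where
  cons : (Fin j → Fin m) → Fin (suc j) → Fin (suc m)
  cons g zero    = zero
  cons g (suc r) = suc (g r)
  cons-inc : ∀ {g} → StrictlyIncreasing g → StrictlyIncreasing (cons g)
  cons-inc g-inc zero    (suc s) _         = s≤s z≤n
  cons-inc g-inc (suc r) (suc s) (s≤s r<s) = s≤s (g-inc r s r<s)
  cons-p : ∀ {g} → (∀ r → p (suc (g r)) ≡ true) → ∀ r → p (cons g r) ≡ true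
  cons-p pg zero    = p0
  cons-p pg (suc r) = pg r

toFin : ∀ {m} → 0 < m → ℕ → Fin m
toFin {m} 0<m i with i <? m
... | yes i<m = fromℕ< i<m
... | no _    = fromℕ< 0<m

toℕ-toFin : ∀ {m} (0<m : 0 < m) {i} → i < m → toℕ (toFin 0<m i) ≡ i
toℕ-toFin {m} 0<m {i} i<m with i <? m
... | yes i<m′ = toℕ-fromℕ< i<m′
... | no i≮m   = ⊥-elim (i≮m i<m)

toFin-toℕ : ∀ {m} (0<m : 0 < m) (i : Fin m) → toFin 0<m (toℕ i) ≡ i
toFin-toℕ 0<m i = toℕ-injective (toℕ-toFin 0<m (toℕ<n i))

transpose-at-i : ∀ {m} (i j : Fin m) → PC.transpose i j i ≡ j
transpose-at-i i j rewrite dec-true (i ≟ᶠ i) refl = refl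

transpose-at-j : ∀ {m} {i j : Fin m} → i ≢ j → PC.transpose i j j ≡ i
transpose-at-j {i = i} {j} i≢j rewrite dec-false (j ≟ᶠ i) (i≢j ∘ sym) | dec-true (j ≟ᶠ j) refl = refl

transpose-other : ∀ {m} {i j e : Fin m} → e ≢ i → e ≢ j → PC.transpose i j e ≡ e
transpose-other {i = i} {j} {e} e≢i e≢j rewrite dec-false (e ≟ᶠ i) e≢i | dec-false (e ≟ᶠ j) e≢j = refl

module _ {a} {A : Set a} where

  infix 4 _≼_

  _≼_ : List A → List A → Set a
  u ≼ w = Prefix _≡_ u w

  ≼-refl : ∀ {u} → u ≼ u
  ≼-refl = fromPointwise (Pointwise.refl refl)

  ≼-trans : ∀ {u v w} → u ≼ v → v ≼ w → u ≼ w
  ≼-trans = Data.List.Relation.Binary.Prefix.Heterogeneous.Properties.trans trans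

  ≼-++ : ∀ u w → u ≼ u ++ w
  ≼-++ u w = ≼-refl ++ᵖ w

  ≼-view : ∀ {u p} → u ≼ p → ∃ λ w → p ≡ u ++ w
  ≼-view u≼p with Prefix._++_ us w ← toView u≼p = w , cong (_++ w) (sym (Pointwise-≡⇒≡ us))

  ≼-≡ : ∀ {u p} → u ≼ p → length p ≤ length u → u ≡ p
  ≼-≡ u≼p p≤u = Pointwise-≡⇒≡ (toPointwise (≤-antisym (length-mono u≼p) p≤u) u≼p)

  ≼-∷ʳ⁺ : ∀ {u w} r → u ≼ w → u ≼ w ∷ʳ r
  ≼-∷ʳ⁺ {w = w} r u≼w = ≼-trans u≼w (≼-++ w [ r ])

  ∷ʳ-≼⁻ : ∀ {v r p} → v ∷ʳ r ≼ p → v ≼ p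
  ∷ʳ-≼⁻ {v} {r} = ≼-trans (≼-++ v [ r ])

  ≼-∷ʳ⁻ : ∀ {u} w r → u ≼ w ∷ʳ r → u ≼ w ⊎ u ≡ w ∷ʳ r
  ≼-∷ʳ⁻ {[]}         w        r []            = inj₁ []
  ≼-∷ʳ⁻ {_ ∷ []}     []       r (refl ∷ [])   = inj₂ refl
  ≼-∷ʳ⁻ {_ ∷ _ ∷ _}  []       r (refl ∷ ())
  ≼-∷ʳ⁻ {x ∷ u}      (_ ∷ w)  r (refl ∷ u≼w) with ≼-∷ʳ⁻ w r u≼w
  ... | inj₁ u≼w′ = inj₁ (refl ∷ u≼w′)
  ... | inj₂ u≡wr = inj₂ (cong (x ∷_) u≡wr)

  ∷ʳ-≢ : ∀ {v w : List A} {r s} → v ≢ w → v ∷ʳ r ≢ w ∷ʳ s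
  ∷ʳ-≢ {v} {w} v≢w = v≢w ∘ proj₁ ∘ ∷ʳ-injective v w

  ∷ʳ-≼-injective : ∀ {v r s p} → v ∷ʳ r ≼ p → v ∷ʳ s ≼ p → r ≡ s
  ∷ʳ-≼-injective {[]}    (refl ∷ _) (refl ∷ _) = refl
  ∷ʳ-≼-injective {_ ∷ v} (refl ∷ p) (refl ∷ q) = ∷ʳ-≼-injective {v} p q

  ≼-child : ∀ {v p} → v ≼ p → p ≢ v → ∃ λ r → v ∷ʳ r ≼ p
  ≼-child {[]}    {[]}    []           p≢v = ⊥-elim (p≢v refl)
  ≼-child {[]}    {r ∷ p} []           _   = r , refl ∷ []
  ≼-child {x ∷ v}         (refl ∷ v≼p) p≢v with ≼-child v≼p (p≢v ∘ cong (x ∷_))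
  ... | r , vr≼p = r , refl ∷ vr≼p

  length-∷ʳ : ∀ (v : List A) s → length (v ∷ʳ s) ≡ suc (length v)
  length-∷ʳ v s = trans (length-++ v) (+-comm (length v) 1)

  ∷ʳ-⋠ : ∀ {w p} r → length p ≤ length w → ¬ (w ∷ʳ r ≼ p)
  ∷ʳ-⋠ {w} {p} r p≤w wr≼p = 1+n≰n (begin
    suc (length w)      ≡⟨ length-∷ʳ w r ⟨
    length (w ∷ʳ r)     ≤⟨ length-mono wr≼p ⟩
    length p            ≤⟨ p≤w ⟩
    length w            ∎)
    where open ≤-Reasoning

-- The vertices of one layer, from left to right

module _ {k : ℕ} where

  infix 4 _◁_ _◁?_

  data _◁_ : Vertex k → Vertex k → Set where
    here  : ∀ {r s p q} → r <ᶠ s → r ∷ p ◁ s ∷ q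
    there : ∀ {r p q} → p ◁ q → r ∷ p ◁ r ∷ q

  ◁-≼ : ∀ {a b p q} → a ◁ b → a ≼ p → b ≼ q → p ◁ q
  ◁-≼ (here r<s)  (refl ∷ _)   (refl ∷ _)   = here r<s
  ◁-≼ (there a◁b) (refl ∷ a≼p) (refl ∷ b≼q) = there (◁-≼ a◁b a≼p b≼q)

  ◁-asym : ∀ {p q} → p ◁ q → ¬ (q ◁ p)
  ◁-asym (here r<s)  (here s<r)  = <-asym r<s s<r
  ◁-asym (here r<r)  (there _)   = <-irrefl refl r<r
  ◁-asym (there _)   (here r<r)  = <-irrefl refl r<r
  ◁-asym (there p◁q) (there q◁p) = ◁-asym p◁q q◁p

  ◁⇒≢ : ∀ {p q} → p ◁ q → p ≢ q
  ◁⇒≢ p◁p refl = ◁-asym p◁p p◁p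

  ∷ʳ-◁ : ∀ v {r s} → r <ᶠ s → v ∷ʳ r ◁ v ∷ʳ s
  ∷ʳ-◁ []      r<s = here r<s
  ∷ʳ-◁ (_ ∷ v) r<s = there (∷ʳ-◁ v r<s)

  _◁?_ : ∀ p q → Dec (p ◁ q)
  []    ◁? _     = no λ ()
  _ ∷ _ ◁? []    = no λ ()
  r ∷ p ◁? s ∷ q with r <ᶠ? s | r ≟ᶠ s
  ... | yes r<s | _        = yes (here r<s)
  ... | no r≮s  | no r≢s   = no λ { (here r<s) → r≮s r<s ; (there _) → r≢s refl }
  ... | no r≮s  | yes refl with p ◁? q
  ...   | yes p◁q = yes (there p◁q)
  ...   | no p⋪q  = no λ { (here r<r) → r≮s r<r ; (there p◁q) → p⋪q p◁q }

  ◁-trichotomy : ∀ p q → length p ≡ length q → p ≡ q ⊎ p ◁ q ⊎ q ◁ p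
  ◁-trichotomy []      []      _ = inj₁ refl
  ◁-trichotomy (r ∷ p) (s ∷ q) |p|≡|q| with <-cmp (toℕ r) (toℕ s)
  ... | tri< r<s _ _ = inj₂ (inj₁ (here r<s))
  ... | tri> _ _ s<r = inj₂ (inj₂ (here s<r))
  ... | tri≈ _ r≡s _ with toℕ-injective r≡s | ◁-trichotomy p q (suc-injective |p|≡|q|)
  ...   | refl | inj₁ refl        = inj₁ refl
  ...   | refl | inj₂ (inj₁ p◁q) = inj₂ (inj₁ (there p◁q))
  ...   | refl | inj₂ (inj₂ q◁p) = inj₂ (inj₂ (there q◁p))

  infix 4 _≼?_ _≟ᵛ_
  infix 5 _≼ᵇ_

  _≟ᵛ_ : (u w : Vertex k) → Dec (u ≡ w)
  _≟ᵛ_ = ≡-dec _≟ᶠ_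

  _≼?_ : (u p : Vertex k) → Dec (u ≼ p)
  _≼?_ = prefix? _≟ᶠ_

  _≼ᵇ_ : Vertex k → Vertex k → Bool
  u ≼ᵇ p = does (u ≼? p)

  ≼ᵇ-∷ʳ : ∀ {u} w r → u ≢ w ∷ʳ r → u ≼ᵇ w ∷ʳ r ≡ u ≼ᵇ w
  ≼ᵇ-∷ʳ {u} w r u≢wr = does-⇔ (mk⇔ one-step-up (≼-∷ʳ⁺ r)) (u ≼? w ∷ʳ r) (u ≼? w)
    where
    one-step-up : u ≼ w ∷ʳ r → u ≼ w
    one-step-up u≼wr with ≼-∷ʳ⁻ w r u≼wr
    ... | inj₁ u≼w  = u≼w
    ... | inj₂ u≡wr = ⊥-elim (u≢wr u≡wr)

  rank : Vertex k → ℕ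
  rank []      = 0
  rank (r ∷ p) = toℕ r * k ^ length p + rank p

  rank< : ∀ p → rank p < k ^ length p
  rank< []      = s≤s z≤n
  rank< (r ∷ p) = <-≤-trans (m*n+o<[1+m]*n (toℕ r) (k ^ length p) (rank< p)) (*-monoˡ-≤ (k ^ length p) (toℕ<n r))

  ◁⇒rank< : ∀ {p q} → length p ≡ length q → p ◁ q → rank p < rank q
  ◁⇒rank< {r ∷ p} {s ∷ q} |p|≡|q| (here r<s) rewrite suc-injective |p|≡|q| =
    <-≤-trans (m*n+o<[1+m]*n (toℕ r) (k ^ length q) (subst (λ l → rank p < k ^ l) (suc-injective |p|≡|q|) (rank< p)))
              (≤-trans (*-monoˡ-≤ (k ^ length q) r<s) (m≤m+n _ (rank q)))
  ◁⇒rank< {r ∷ p} {r ∷ q} |p|≡|q| (there p◁q) rewrite suc-injective |p|≡|q| =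
    +-monoʳ-< (toℕ r * k ^ length q) (◁⇒rank< (suc-injective |p|≡|q|) p◁q)

  rank-injective : ∀ {p q} → length p ≡ length q → rank p ≡ rank q → p ≡ q
  rank-injective {p} {q} |p|≡|q| rp≡rq with ◁-trichotomy p q |p|≡|q|
  ... | inj₁ p≡q       = p≡q
  ... | inj₂ (inj₁ p◁q) = ⊥-elim (<-irrefl rp≡rq (◁⇒rank< |p|≡|q| p◁q))
  ... | inj₂ (inj₂ q◁p) = ⊥-elim (<-irrefl (sym rp≡rq) (◁⇒rank< (sym |p|≡|q|) q◁p))

  rank-++ : ∀ t w → rank (t ++ w) ≡ rank t * k ^ length w + rank w
  rank-++ []      w = refl
  rank-++ (r ∷ t) w = begin
    toℕ r * k ^ length (t ++ w) + rank (t ++ w)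
      ≡⟨ cong₂ (λ l x → toℕ r * k ^ l + x) (length-++ t) (rank-++ t w) ⟩
    toℕ r * k ^ (length t + length w) + (rank t * K + rank w)
      ≡⟨ cong (λ x → toℕ r * x + (rank t * K + rank w)) (^-distribˡ-+-* k (length t) (length w)) ⟩
    toℕ r * (k ^ length t * K) + (rank t * K + rank w)
      ≡⟨ cong (_+ (rank t * K + rank w)) (sym (*-assoc (toℕ r) (k ^ length t) K)) ⟩
    toℕ r * k ^ length t * K + (rank t * K + rank w)
      ≡⟨ sym (+-assoc (toℕ r * k ^ length t * K) (rank t * K) (rank w)) ⟩
    toℕ r * k ^ length t * K + rank t * K + rank w
      ≡⟨ cong (_+ rank w) (sym (*-distribʳ-+ K (toℕ r * k ^ length t) (rank t))) ⟩
    (toℕ r * k ^ length t + rank t) * K + rank w ∎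
    where
    open ≡-Reasoning
    K = k ^ length w

  ≼⇒rank-range : ∀ {t p} → t ≼ p → let K = k ^ (length p ∸ length t) in
                 rank t * K ≤ rank p × rank p < suc (rank t) * K
  ≼⇒rank-range {t} t≼p with ≼-view t≼p
  ... | w , refl rewrite rank-++ t w | length-++ t {w} | m+n∸m≡n (length t) (length w) =
    m≤m+n _ _ , m*n+o<[1+m]*n (rank t) (k ^ length w) (rank< w)

  rank-range⇒≼ : ∀ t p → length t ≤ length p → let K = k ^ (length p ∸ length t) in
                 rank t * K ≤ rank p → rank p < suc (rank t) * K → t ≼ p
  rank-range⇒≼ t p t≤p lower upper =
    subst (t ≼_) (take++drop≡id (length t) p) (subst (_≼ p₁ ++ p₂) (rank-injective |p₁|≡|t| rp₁≡rt) (≼-++ p₁ p₂))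
    where
    p₁ = take (length t) p
    p₂ = drop (length t) p
    K = k ^ (length p ∸ length t)
    |p₁|≡|t| : length p₁ ≡ length t
    |p₁|≡|t| = trans (length-take (length t) p) (m≤n⇒m⊓n≡m t≤p)
    rank-p : rank p ≡ rank p₁ * K + rank p₂
    rank-p = trans (cong rank (sym (take++drop≡id (length t) p)))
                   (trans (rank-++ p₁ p₂) (cong (λ l → rank p₁ * k ^ l + rank p₂) (length-drop (length t) p)))
    rp₁≡rt : rank p₁ ≡ rank t
    rp₁≡rt = quotient-unique (rank p₁) (rank t) (rank p₂) K
      (subst (λ l → rank p₂ < k ^ l) (length-drop (length t) p) (rank< p₂))
      (subst (rank t * K ≤_) rank-p lower) (subst (_< suc (rank t) * K) rank-p upper)

-- The k * K chips of a vertex fired in K rounds: chip i goes to child (child i) in round (round i),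
-- and deal j r is the chip sent to child r in round j.
record Dealing (k K : ℕ) : Set where
  field
    deal           : ℕ → ℕ → ℕ
    round child    : ℕ → ℕ
    deal<          : ∀ {j r} → j < K → r < k → deal j r < k * K
    deal-monoʳ     : ∀ {j r r′} → j < K → r < r′ → r′ < k → deal j r < deal j r′
    deal-monoˡ     : ∀ {j j′ r} → j < j′ → j′ < K → r < k → deal j r < deal j′ r
    round-deal     : ∀ {j r} → j < K → r < k → round (deal j r) ≡ j
    child-deal     : ∀ {j r} → j < K → r < k → child (deal j r) ≡ r
    deal-round-child : ∀ {i} → i < k * K → deal (round i) (child i) ≡ i
    round<         : ∀ {i} → i < k * K → round i < K
    child<         : ∀ {i} → i < k * K → child i < k

-- K rounds of k chips: the first u * K chips go round-robin to the children 0 … u-1,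
-- the remaining ones round-robin to the children u … k-1.
module SplitDealing (k u K : ℕ) (u≤k : u ≤ k) where

  w : ℕ
  w = k ∸ u

  deal : ℕ → ℕ → ℕ
  deal j r with r <? u
  ... | yes _ = j * u + r
  ... | no _  = u * K + (j * w + (r ∸ u))

  round child : ℕ → ℕ
  round i with i <? u * K
  ... | yes _ = quot i u
  ... | no _  = quot (i ∸ u * K) w
  child i with i <? u * K
  ... | yes _ = rem i u
  ... | no _  = u + rem (i ∸ u * K) w

  deal-low : ∀ j {r} → r < u → deal j r ≡ j * u + r
  deal-low j {r} r<u with r <? u
  ... | yes _   = refl
  ... | no r≮u = ⊥-elim (r≮u r<u)

  deal-high : ∀ j {r} → ¬ r < u → deal j r ≡ u * K + (j * w + (r ∸ u))
  deal-high j {r} r≮u with r <? u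
  ... | yes r<u = ⊥-elim (r≮u r<u)
  ... | no _    = refl

  k*K≡ : k * K ≡ u * K + K * w
  k*K≡ = trans (cong (_* K) (sym (m+[n∸m]≡n u≤k))) (trans (*-distribʳ-+ K u w) (cong (u * K +_) (*-comm w K)))

  r-u<w : ∀ {r} → r < k → ¬ r < u → r ∸ u < w
  r-u<w r<k r≮u = ∸-monoˡ-< r<k (≮⇒≥ r≮u)

  high-block : ∀ {i} → i < k * K → ¬ i < u * K → i ∸ u * K < K * w
  high-block {i} i<kK i≮uK = subst (i ∸ u * K <_) (m+n∸m≡n (u * K) (K * w)) (∸-monoˡ-< (subst (i <_) k*K≡ i<kK) (≮⇒≥ i≮uK))

  deal< : ∀ {j r} → j < K → r < k → deal j r < k * K
  deal< {j} {r} j<K r<k with r <? u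
  ... | yes r<u = ≤-trans (radix< K u j<K r<u) (≤-trans (≤-reflexive (*-comm K u)) (*-monoˡ-≤ K u≤k))
  ... | no r≮u  = subst (u * K + (j * w + (r ∸ u)) <_) (sym k*K≡) (+-monoʳ-< (u * K) (radix< K w j<K (r-u<w r<k r≮u)))

  deal-monoʳ : ∀ {j r r′} → j < K → r < r′ → r′ < k → deal j r < deal j r′
  deal-monoʳ {j} {r} {r′} j<K r<r′ r′<k with r <? u | r′ <? u
  ... | yes _   | yes _    = +-monoʳ-< (j * u) r<r′
  ... | yes r<u | no _     = ≤-trans (radix< K u j<K r<u) (≤-trans (≤-reflexive (*-comm K u)) (m≤m+n (u * K) _))
  ... | no r≮u  | yes r′<u = ⊥-elim (r≮u (<-trans r<r′ r′<u))
  ... | no r≮u  | no _     = +-monoʳ-< (u * K) (+-monoʳ-< (j * w) (∸-monoˡ-< r<r′ (≮⇒≥ r≮u)))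

  deal-monoˡ : ∀ {j j′ r} → j < j′ → j′ < K → r < k → deal j r < deal j′ r
  deal-monoˡ {r = r} j<j′ j′<K r<k with r <? u
  ... | yes r<u = radix-mono r u j<j′ r<u
  ... | no r≮u  = +-monoʳ-< (u * K) (radix-mono (r ∸ u) w j<j′ (r-u<w r<k r≮u))

  round-child-deal : ∀ {j r} → j < K → r < k → round (deal j r) ≡ j × child (deal j r) ≡ r
  round-child-deal {j} {r} j<K r<k with r <? u
  ... | yes r<u with j * u + r <? u * K
  ...   | yes _     = quot-rem-of j r<u
  ...   | no ≮uK    = ⊥-elim (≮uK (subst (j * u + r <_) (*-comm K u) (radix< K u j<K r<u)))
  round-child-deal {j} {r} j<K r<k | no r≮u with u * K + (j * w + (r ∸ u)) <? u * K
  ...   | yes <uK   = ⊥-elim (<⇒≱ <uK (m≤m+n _ _))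
  ...   | no _ rewrite m+n∸m≡n (u * K) (j * w + (r ∸ u)) =
    let round≡ , rem≡ = quot-rem-of j (r-u<w r<k r≮u) in round≡ , trans (cong (u +_) rem≡) (m+[n∸m]≡n (≮⇒≥ r≮u))

  deal-round-child : ∀ {i} → i < k * K → deal (round i) (child i) ≡ i
  deal-round-child {i} i<kK with i <? u * K
  ... | yes i<uK = trans (deal-low _ (rem< i 0<u)) (sym (quot-rem i 0<u))
    where
    0<u : 0 < u
    0<u = factor-positive K u (subst (i <_) (*-comm u K) i<uK)
  ... | no i≮uK = trans (deal-high _ (λ lt → <⇒≱ lt (m≤m+n u _))) (begin
    u * K + (quot i′ w * w + (u + rem i′ w ∸ u))   ≡⟨ cong (λ x → u * K + (quot i′ w * w + x)) (m+n∸m≡n u (rem i′ w)) ⟩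
    u * K + (quot i′ w * w + rem i′ w)             ≡⟨ cong (u * K +_) (quot-rem i′ 0<w) ⟨
    u * K + i′                                     ≡⟨ m+[n∸m]≡n (≮⇒≥ i≮uK) ⟩
    i                                              ∎)
    where
    open ≡-Reasoning
    i′ = i ∸ u * K
    0<w : 0 < w
    0<w = factor-positive K w (high-block i<kK i≮uK)

  round< : ∀ {i} → i < k * K → round i < K
  round< {i} i<kK with i <? u * K
  ... | yes i<uK = quot< i u K (subst (i <_) (*-comm u K) i<uK)
  ... | no i≮uK  = quot< (i ∸ u * K) w K (high-block i<kK i≮uK)

  child< : ∀ {i} → i < k * K → child i < k
  child< {i} i<kK with i <? u * K
  ... | yes i<uK = ≤-trans (rem< i (factor-positive K u (subst (i <_) (*-comm u K) i<uK))) u≤k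
  ... | no i≮uK  = subst (u + rem (i ∸ u * K) w <_) (m+[n∸m]≡n u≤k)
                     (+-monoʳ-< u (rem< (i ∸ u * K) (factor-positive K w (high-block i<kK i≮uK))))

  dealing : Dealing k K
  dealing = record
    { deal = deal ; round = round ; child = child ; deal< = deal< ; deal-monoʳ = deal-monoʳ ; deal-monoˡ = deal-monoˡ
    ; round-deal = λ j<K r<k → proj₁ (round-child-deal j<K r<k) ; child-deal = λ j<K r<k → proj₂ (round-child-deal j<K r<k)
    ; deal-round-child = deal-round-child ; round< = round< ; child< = child< }

module Game (k n : ℕ) where

  N : ℕ
  N = k ^ n

  subtreeCount : Config k n → (Chip k n → Bool) → Vertex k → ℕ
  subtreeCount h q u = count (λ e → q e ∧ (u ≼ᵇ h e))

  occupancy : Config k n → Vertex k → ℕ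
  occupancy h u = count (λ e → does (h e ≟ᵛ u))

  module Firing {h h′ : Config k n} (F : Fire k n h h′) where

    vertex : Vertex k
    vertex = proj₁ F

    chip : Fin k → Chip k n
    chip = proj₁ (proj₂ F)

    chip-increasing : StrictlyIncreasing chip
    chip-increasing = proj₁ (proj₂ (proj₂ F))

    chip-from : ∀ r → h (chip r) ≡ vertex
    chip-from = proj₁ (proj₂ (proj₂ (proj₂ F)))

    chip-to : ∀ r → h′ (chip r) ≡ vertex ∷ʳ r
    chip-to = proj₁ (proj₂ (proj₂ (proj₂ (proj₂ F))))

    others-stay : ∀ d → (∀ r → d ≢ chip r) → h′ d ≡ h d
    others-stay = proj₂ (proj₂ (proj₂ (proj₂ (proj₂ F))))

    fired? : ∀ d → (∃ λ r → d ≡ chip r) ⊎ (∀ r → d ≢ chip r)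
    fired? d with any? (λ r → d ≟ᶠ chip r)
    ... | yes fired    = inj₁ fired
    ... | no not-fired = inj₂ λ r d≡r → not-fired (r , d≡r)

    moves-down : ∀ d → h d ≼ h′ d
    moves-down d with fired? d
    ... | inj₁ (r , refl) rewrite chip-from r | chip-to r = ≼-++ vertex [ r ]
    ... | inj₂ not-fired  rewrite others-stay d not-fired = ≼-refl

    ≼ᵇ-unchanged : ∀ u d → (∀ r → d ≡ chip r → u ≢ vertex ∷ʳ r) → u ≼ᵇ h′ d ≡ u ≼ᵇ h d
    ≼ᵇ-unchanged u d not-entered with fired? d
    ... | inj₁ (r , refl) rewrite chip-from r | chip-to r = ≼ᵇ-∷ʳ vertex r (not-entered r refl)
    ... | inj₂ not-fired  rewrite others-stay d not-fired = refl

    subtreeCount-nonchild : ∀ q u → (∀ s → u ≢ vertex ∷ʳ s) → subtreeCount h′ q u ≡ subtreeCount h q u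
    subtreeCount-nonchild q u not-child =
      count-cong λ e → cong (q e ∧_) (≼ᵇ-unchanged u e (λ r _ → not-child r))

    subtreeCount-child : ∀ q s → subtreeCount h′ q (vertex ∷ʳ s) ≡ subtreeCount h q (vertex ∷ʳ s) + indicator (q (chip s))
    subtreeCount-child q s = begin
      sum after                                 ≡⟨ +-identityʳ _ ⟨
      sum after + 0                             ≡⟨ cong (sum after +_) before-s ⟨
      sum after + before (chip s)               ≡⟨ sum-update (chip s) unchanged ⟩
      sum before + after (chip s)               ≡⟨ cong (sum before +_) after-s ⟩
      sum before + indicator (q (chip s))       ∎
      where
      open ≡-Reasoning
      before after : Chip k n → ℕ
      before e = indicator (q e ∧ (vertex ∷ʳ s ≼ᵇ h e))
      after  e = indicator (q e ∧ (vertex ∷ʳ s ≼ᵇ h′ e))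
      unchanged : ∀ e → e ≢ chip s → after e ≡ before e
      unchanged e e≢s = cong (λ b → indicator (q e ∧ b)) (≼ᵇ-unchanged (vertex ∷ʳ s) e
        λ { r refl wr≡vr → e≢s (cong chip (sym (proj₂ (∷ʳ-injective vertex vertex wr≡vr)))) })
      before-s : before (chip s) ≡ 0
      before-s rewrite chip-from s | dec-false (vertex ∷ʳ s ≼? vertex) (∷ʳ-⋠ s ≤-refl) | ∧-zeroʳ (q (chip s)) = refl
      after-s : after (chip s) ≡ indicator (q (chip s))
      after-s rewrite chip-to s | dec-true (vertex ∷ʳ s ≼? vertex ∷ʳ s) ≼-refl | ∧-identityʳ (q (chip s)) = refl

  -- Bounds on the labels reaching a vertex

  ChildrenOrdered : (Fin k → Fin k → Set) → (Chip k n → Bool) → Config k n → Set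
  ChildrenOrdered R q h = ∀ v r s → R r s → subtreeCount h q (v ∷ʳ s) ≤ subtreeCount h q (v ∷ʳ r)

  FiringRespects : (Fin k → Fin k → Set) → (Chip k n → Bool) → Set
  FiringRespects R q = ∀ {h h′} (F : Fire k n h h′) → let open Firing F in
                       ∀ r s → R r s → indicator (q (chip s)) ≤ indicator (q (chip r))

  initial-ordered : ∀ R q → ChildrenOrdered R q (initial k n)
  initial-ordered R q v r s _ = ≤-trans (≤-reflexive (count-none _ nowhere)) z≤n
    where
    nowhere : ∀ e → q e ∧ (v ∷ʳ s ≼ᵇ []) ≡ false
    nowhere e rewrite dec-false (v ∷ʳ s ≼? []) (∷ʳ-⋠ s z≤n) = ∧-zeroʳ (q e)

  fire-ordered : ∀ {R q h h′} → FiringRespects R q → Fire k n h h′ → ChildrenOrdered R q h → ChildrenOrdered R q h′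
  fire-ordered {R} {q} respects F ordered v r s rRs with v ≟ᵛ Firing.vertex F
  ... | yes refl rewrite Firing.subtreeCount-child F q s | Firing.subtreeCount-child F q r =
    +-mono-≤ (ordered v r s rRs) (respects F r s rRs)
  ... | no v≢vertex
    rewrite Firing.subtreeCount-nonchild F q (v ∷ʳ s) (λ _ → ∷ʳ-≢ v≢vertex)
          | Firing.subtreeCount-nonchild F q (v ∷ʳ r) (λ _ → ∷ʳ-≢ v≢vertex) =
    ordered v r s rRs

  star-ordered : ∀ {R q h h′} → FiringRespects R q → Star (Fire k n) h h′ → ChildrenOrdered R q h → ChildrenOrdered R q h′
  star-ordered respects ε        ordered = ordered
  star-ordered respects (F ◅ Fs) ordered = star-ordered respects Fs (fire-ordered respects F ordered)

  Reach : Config k n → Set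
  Reach = Reachable k n (initial k n)

  DownwardClosed UpwardClosed : (Chip k n → Bool) → Set
  DownwardClosed q = ∀ {e e′} → e <ᶠ e′ → q e′ ≡ true → q e ≡ true
  UpwardClosed   q = ∀ {e e′} → e <ᶠ e′ → q e ≡ true → q e′ ≡ true

  downward-ordered : ∀ {q h} → DownwardClosed q → Reach h → ChildrenOrdered _<ᶠ_ q h
  downward-ordered {q} closed reach = star-ordered respects reach (initial-ordered _<ᶠ_ q)
    where
    respects : FiringRespects _<ᶠ_ q
    respects F r s r<s = indicator-mono (closed (Firing.chip-increasing F r s r<s))

  upward-ordered : ∀ {q h} → UpwardClosed q → Reach h → ChildrenOrdered (λ r s → s <ᶠ r) q h
  upward-ordered {q} closed reach = star-ordered respects reach (initial-ordered _ q)
    where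
    respects : FiringRespects (λ r s → s <ᶠ r) q
    respects F r s s<r = indicator-mono (closed (Firing.chip-increasing F s r s<r))

  children-sum : ∀ h q v (w : Fin k → Bool) → sum (λ r → indicator (w r) * subtreeCount h q (v ∷ʳ r)) ≤ subtreeCount h q v
  children-sum h q v w = begin
    sum (λ r → indicator (w r) * subtreeCount h q (v ∷ʳ r))
      ≡⟨ sum-cong-≗ (λ r → *-distribˡ-sum (indicator (w r)) (λ e → indicator (in-child e r))) ⟩
    sum (λ r → sum (λ e → indicator (w r) * indicator (in-child e r)))
      ≡⟨ ∑-comm (λ r e → indicator (w r) * indicator (in-child e r)) ⟩
    sum (λ e → sum (λ r → indicator (w r) * indicator (in-child e r)))
      ≡⟨ sum-cong-≗ (λ e → sum-cong-≗ λ r → indicator-∧ (w r) (in-child e r)) ⟩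
    sum (λ e → count (λ r → w r ∧ in-child e r))
      ≤⟨ sum-mono-≤ (λ e → count-≤-indicator _ _ (in-parent e) (same-child e)) ⟩
    subtreeCount h q v ∎
    where
    open ≤-Reasoning
    in-child : Chip k n → Fin k → Bool
    in-child e r = q e ∧ (v ∷ʳ r ≼ᵇ h e)
    child-≼ : ∀ e r → (w r ∧ in-child e r) ≡ true → v ∷ʳ r ≼ h e
    child-≼ e r wr = does-true⇒ (v ∷ʳ r ≼? h e) (∧-conicalʳ (q e) _ (∧-conicalʳ (w r) _ wr))
    in-parent : ∀ e r → (w r ∧ in-child e r) ≡ true → (q e ∧ (v ≼ᵇ h e)) ≡ true
    in-parent e r wr = trans (cong (_∧ _) (∧-conicalˡ (q e) _ (∧-conicalʳ (w r) _ wr))) (dec-true (v ≼? h e) (∷ʳ-≼⁻ (child-≼ e r wr)))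
    same-child : ∀ e r r′ → (w r ∧ in-child e r) ≡ true → (w r′ ∧ in-child e r′) ≡ true → r ≡ r′
    same-child e r r′ wr wr′ = ∷ʳ-≼-injective (child-≼ e r wr) (child-≼ e r′ wr′)

  weighted-children : ∀ h q v (w : Fin k → Bool) B → (∀ r → w r ≡ true → B ≤ subtreeCount h q (v ∷ʳ r)) →
                      count w * B ≤ subtreeCount h q v
  weighted-children h q v w B B≤ = begin
    count w * B                                            ≡⟨ *-distribʳ-sum B (indicator ∘ w) ⟩
    sum (λ r → indicator (w r) * B)                        ≤⟨ sum-mono-≤ weigh ⟩
    sum (λ r → indicator (w r) * subtreeCount h q (v ∷ʳ r)) ≤⟨ children-sum h q v w ⟩
    subtreeCount h q v                                     ∎
    where
    open ≤-Reasoning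
    weigh : ∀ r → indicator (w r) * B ≤ indicator (w r) * subtreeCount h q (v ∷ʳ r)
    weigh r with w r in wr
    ... | true  = +-monoˡ-≤ 0 (B≤ r wr)
    ... | false = z≤n

  lower-step : ∀ {q h} → ChildrenOrdered _<ᶠ_ q h → ∀ v s → suc (toℕ s) * subtreeCount h q (v ∷ʳ s) ≤ subtreeCount h q v
  lower-step {q} {h} ordered v s =
    subst (λ c → c * subtreeCount h q (v ∷ʳ s) ≤ _) (count-≤ s) (weighted-children h q v (λ r → does (r ≤ᶠ? s)) _ left-of-s)
    where
    left-of-s : ∀ r → does (r ≤ᶠ? s) ≡ true → subtreeCount h q (v ∷ʳ s) ≤ subtreeCount h q (v ∷ʳ r)
    left-of-s r r≤s with m≤n⇒m<n∨m≡n (does-true⇒ (r ≤ᶠ? s) r≤s)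
    ... | inj₁ r<s = ordered v r s r<s
    ... | inj₂ r≡s rewrite toℕ-injective r≡s = ≤-refl

  upper-step : ∀ {q h} → ChildrenOrdered (λ r s → s <ᶠ r) q h → ∀ v s → (k ∸ toℕ s) * subtreeCount h q (v ∷ʳ s) ≤ subtreeCount h q v
  upper-step {q} {h} ordered v s =
    subst (λ c → c * subtreeCount h q (v ∷ʳ s) ≤ _) (count-≥ s) (weighted-children h q v (λ r → does (s ≤ᶠ? r)) _ right-of-s)
    where
    right-of-s : ∀ r → does (s ≤ᶠ? r) ≡ true → subtreeCount h q (v ∷ʳ s) ≤ subtreeCount h q (v ∷ʳ r)
    right-of-s r s≤r with m≤n⇒m<n∨m≡n (does-true⇒ (s ≤ᶠ? r) s≤r)
    ... | inj₁ s<r = ordered v r s s<r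
    ... | inj₂ s≡r rewrite toℕ-injective s≡r = ≤-refl

  every : Chip k n → Bool
  every _ = true

  children-balanced : ∀ {h} → Reach h → ∀ v r s → subtreeCount h every (v ∷ʳ r) ≤ subtreeCount h every (v ∷ʳ s)
  children-balanced reach v r s with <-cmp (toℕ r) (toℕ s)
  ... | tri< r<s _ _ = upward-ordered (λ _ _ → refl) reach v s r r<s
  ... | tri≈ _ r≡s _ rewrite toℕ-injective r≡s = ≤-refl
  ... | tri> _ _ s<r = downward-ordered (λ _ _ → refl) reach v s r s<r

  balanced-step : ∀ {h} → Reach h → ∀ v s → k * subtreeCount h every (v ∷ʳ s) ≤ subtreeCount h every v
  balanced-step {h} reach v s =
    subst (λ c → c * subtreeCount h every (v ∷ʳ s) ≤ subtreeCount h every v) (count-all {k} (λ _ → true) (λ _ → refl))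
    (weighted-children h every v (λ _ → true) _ (λ r _ → children-balanced reach v s r))

  product-bound : ∀ {q h} (c : Fin k → ℕ) → (∀ v s → c s * subtreeCount h q (v ∷ʳ s) ≤ subtreeCount h q v) →
                  ∀ {d} → q d ≡ true → ∀ t v → v ++ t ≼ h d → foldr _*_ 1 (map c t) ≤ subtreeCount h q v
  product-bound {q} {h} c step {d} qd [] v v≼ =
    count-≥1 _ d (trans (cong (_∧ _) qd) (dec-true (v ≼? h d) (subst (_≼ h d) (++-identityʳ v) v≼)))
  product-bound c step qd (s ∷ t) v v≼ =
    ≤-trans (*-monoʳ-≤ (c s) (product-bound c step qd t (v ∷ʳ s) (subst (_≼ _) (sym (++-assoc v [ s ] t)) v≼))) (step v s)

  subtreeCount-root : ∀ h q → subtreeCount h q [] ≡ count q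
  subtreeCount-root h q = count-cong (λ e → ∧-identityʳ (q e))

  product-const : ∀ (t : Vertex k) → foldr _*_ 1 (map (λ _ → k) t) ≡ k ^ length t
  product-const []      = refl
  product-const (_ ∷ t) = cong (k *_) (product-const t)

  prodT≤label : ∀ {h} → Reach h → ∀ t d → t ≼ h d → prodT t ≤ suc (toℕ d)
  prodT≤label {h} reach t d t≼ = subst (prodT t ≤_) (trans (subtreeCount-root h _) (count-≤ d))
    (product-bound (suc ∘ toℕ) (lower-step (downward-ordered closed reach)) (dec-true (d ≤ᶠ? d) ≤-refl) t [] t≼)
    where
    closed : DownwardClosed (λ e → does (e ≤ᶠ? d))
    closed {e} {e′} e<e′ e′≤d = dec-true (e ≤ᶠ? d) (≤-trans (<⇒≤ e<e′) (does-true⇒ (e′ ≤ᶠ? d) e′≤d))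

  prodK≤chips-from : ∀ {h} → Reach h → ∀ t d → t ≼ h d → prodK k t ≤ N ∸ toℕ d
  prodK≤chips-from {h} reach t d t≼ = subst (prodK k t ≤_) (trans (subtreeCount-root h _) (count-≥ d))
    (product-bound (λ r → k ∸ toℕ r) (upper-step (upward-ordered closed reach)) (dec-true (d ≤ᶠ? d) ≤-refl) t [] t≼)
    where
    closed : UpwardClosed (λ e → does (d ≤ᶠ? e))
    closed {e} {e′} e<e′ d≤e = dec-true (d ≤ᶠ? e′) (≤-trans (does-true⇒ (d ≤ᶠ? e) d≤e) (<⇒≤ e<e′))

  depth-bound : ∀ {h} → Reach h → ∀ d → k ^ length (h d) ≤ N
  depth-bound {h} reach d = subst₂ _≤_ (product-const (h d)) (trans (subtreeCount-root h every) (count-all {N} _ (λ _ → refl)))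
    (product-bound (λ _ → k) (balanced-step reach) refl (h d) [] ≼-refl)

  -- Stable configurations

  indicator-split : ∀ (u p : Vertex k) → indicator (u ≼ᵇ p) ≡ indicator (does (p ≟ᵛ u)) + sum (λ r → indicator (u ∷ʳ r ≼ᵇ p))
  indicator-split u p with u ≼? p | p ≟ᵛ u
  ... | yes _   | yes refl = cong suc (sym (sum-zero λ r → cong indicator (dec-false (u ∷ʳ r ≼? u) (∷ʳ-⋠ r ≤-refl))))
  ... | yes u≼p | no p≢u with ≼-child u≼p p≢u
  ...   | r , ur≼p = sym (trans (sum-single r λ s s≢r → cong indicator (dec-false (u ∷ʳ s ≼? p) (s≢r ∘ λ us≼p → ∷ʳ-≼-injective us≼p ur≼p)))
                                (cong indicator (dec-true (u ∷ʳ r ≼? p) ur≼p)))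
  indicator-split u p | no u⋠p | yes refl = ⊥-elim (u⋠p ≼-refl)
  indicator-split u p | no u⋠p | no _     = sym (sum-zero λ r → cong indicator (dec-false (u ∷ʳ r ≼? p) (u⋠p ∘ ∷ʳ-≼⁻)))

  subtreeCount-split : ∀ h u → subtreeCount h every u ≡ occupancy h u + sum (λ r → subtreeCount h every (u ∷ʳ r))
  subtreeCount-split h u = begin
    sum (λ e → indicator (u ≼ᵇ h e))
      ≡⟨ sum-cong-≗ (λ e → indicator-split u (h e)) ⟩
    sum (λ e → indicator (does (h e ≟ᵛ u)) + sum (λ r → indicator (u ∷ʳ r ≼ᵇ h e)))
      ≡⟨ ∑-distrib-+ (λ e → indicator (does (h e ≟ᵛ u))) (λ e → sum (λ r → indicator (u ∷ʳ r ≼ᵇ h e))) ⟩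
    occupancy h u + sum (λ e → sum (λ r → indicator (u ∷ʳ r ≼ᵇ h e)))
      ≡⟨ cong (occupancy h u +_) (∑-comm (λ e r → indicator (u ∷ʳ r ≼ᵇ h e))) ⟩
    occupancy h u + sum (λ r → subtreeCount h every (u ∷ʳ r)) ∎
    where open ≡-Reasoning

  fire-exists : ∀ {h} u (g : Fin k → Chip k n) → StrictlyIncreasing g → (∀ r → h (g r) ≡ u) → ∃ (Fire k n h)
  fire-exists {h} u g g-inc g-at = h′ , u , g , g-inc , g-at , to , rest
    where
    h′ : Config k n
    h′ d with any? (λ r → d ≟ᶠ g r)
    ... | yes (r , _) = u ∷ʳ r
    ... | no _        = h d
    to : ∀ r → h′ (g r) ≡ u ++ [ r ]
    to r with any? (λ r′ → g r ≟ᶠ g r′)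
    ... | yes (r′ , gr≡gr′) rewrite increasing⇒injective g-inc r r′ gr≡gr′ = refl
    ... | no not-fired = ⊥-elim (not-fired (r , refl))
    rest : ∀ d → (∀ r → d ≢ g r) → h′ d ≡ h d
    rest d not-fired with any? (λ r → d ≟ᶠ g r)
    ... | yes (r , d≡gr) = ⊥-elim (not-fired r d≡gr)
    ... | no _           = refl

  stable⇒occupancy<k : ∀ {h} → Stable k n h → ∀ u → occupancy h u < k
  stable⇒occupancy<k {h} stable u with k ≤? occupancy h u
  ... | no k≰occ = ≰⇒> k≰occ
  ... | yes k≤occ with increasing-witnesses (λ e → does (h e ≟ᵛ u)) k k≤occ
  ...   | g , g-inc , g-at = ⊥-elim (stable (fire-exists u g g-inc λ r → does-true⇒ (h (g r) ≟ᵛ u) (g-at r)))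

  module _ (2≤k : 2 ≤ k) where

    0<k : 0 < k
    0<k = <-≤-trans z<s 2≤k

    depth≤n : ∀ {h} → Reach h → ∀ d → length (h d) ≤ n
    depth≤n reach d = ≮⇒≥ λ n<depth → <⇒≱ (^-monoʳ-< k 2≤k n<depth) (depth-bound reach d)

    module StableReachable {h} (reach : Reach h) (stable : Stable k n h) where

      children-equal : ∀ v r s → subtreeCount h every (v ∷ʳ r) ≡ subtreeCount h every (v ∷ʳ s)
      children-equal v r s = ≤-antisym (children-balanced reach v r s) (children-balanced reach v s r)

      occupancy+children : ∀ u s → subtreeCount h every u ≡ occupancy h u + subtreeCount h every (u ∷ʳ s) * k
      occupancy+children u s = begin
        subtreeCount h every u                                        ≡⟨ subtreeCount-split h u ⟩
        occupancy h u + sum (λ r → subtreeCount h every (u ∷ʳ r))     ≡⟨ cong (occupancy h u +_) (sum-cong-≗ λ r → children-equal u r s) ⟩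
        occupancy h u + sum {k} (λ _ → subtreeCount h every (u ∷ʳ s)) ≡⟨ cong (occupancy h u +_) (sum-const k _) ⟩
        occupancy h u + k * subtreeCount h every (u ∷ʳ s)             ≡⟨ cong (occupancy h u +_) (*-comm k _) ⟩
        occupancy h u + subtreeCount h every (u ∷ʳ s) * k             ∎
        where open ≡-Reasoning

      exact-step : ∀ u → length u < n → subtreeCount h every u ≡ k ^ (n ∸ length u) →
                   occupancy h u ≡ 0 × ∀ s → subtreeCount h every (u ∷ʳ s) ≡ k ^ (n ∸ suc (length u))
      exact-step u u<n exact = sym (proj₂ (split (fromℕ< 2≤k))) , λ s → sym (proj₁ (split s))
        where
        split : ∀ s → k ^ (n ∸ suc (length u)) ≡ subtreeCount h every (u ∷ʳ s) × 0 ≡ occupancy h u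
        split s = divmod-unique k 0<k (stable⇒occupancy<k stable u) (begin
          k ^ (n ∸ suc (length u)) * k + 0     ≡⟨ +-identityʳ _ ⟩
          k ^ (n ∸ suc (length u)) * k         ≡⟨ *-comm _ k ⟩
          k ^ suc (n ∸ suc (length u))         ≡⟨ cong (k ^_) (+-∸-assoc 1 u<n) ⟨
          k ^ (n ∸ length u)                   ≡⟨ exact ⟨
          subtreeCount h every u               ≡⟨ occupancy+children u s ⟩
          occupancy h u + subtreeCount h every (u ∷ʳ s) * k ≡⟨ +-comm (occupancy h u) _ ⟩
          subtreeCount h every (u ∷ʳ s) * k + occupancy h u ∎)
          where open ≡-Reasoning

      exact-below : ∀ w v → length (v ++ w) ≤ n → subtreeCount h every v ≡ k ^ (n ∸ length v) →
                    subtreeCount h every (v ++ w) ≡ k ^ (n ∸ length (v ++ w))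
      exact-below []      v _     exact rewrite ++-identityʳ v = exact
      exact-below (s ∷ w) v vsw≤n exact =
        subst (λ u → subtreeCount h every u ≡ k ^ (n ∸ length u)) (++-assoc v [ s ] w)
          (exact-below w (v ∷ʳ s) (subst (λ u → length u ≤ n) (sym (++-assoc v [ s ] w)) vsw≤n)
            (trans (proj₂ (exact-step v v<n exact) s) (cong (λ l → k ^ (n ∸ l)) (sym (length-∷ʳ v s)))))
        where
        v<n : length v < n
        v<n = begin-strict
          length v               <⟨ n<1+n _ ⟩
          suc (length v)         ≤⟨ m≤m+n _ (length w) ⟩
          suc (length v + length w) ≡⟨ +-suc (length v) (length w) ⟨
          length v + length (s ∷ w) ≡⟨ length-++ v ⟨
          length (v ++ s ∷ w)    ≤⟨ vsw≤n ⟩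
          n                      ∎
          where open ≤-Reasoning

      subtree-exact : ∀ u → length u ≤ n → subtreeCount h every u ≡ k ^ (n ∸ length u)
      subtree-exact u u≤n = exact-below u [] u≤n (trans (subtreeCount-root h every) (count-all {N} _ λ _ → refl))

      chip-depth : ∀ d → length (h d) ≡ n
      chip-depth d with <-cmp (length (h d)) n
      ... | tri≈ _ depth≡n _ = depth≡n
      ... | tri> _ _ n<depth = ⊥-elim (<⇒≱ n<depth (depth≤n reach d))
      ... | tri< depth<n _ _ = ⊥-elim (<⇒≱ (count-≥1 _ d (dec-true (h d ≟ᵛ h d) refl))
              (≤-reflexive (proj₁ (exact-step (h d) depth<n (subtree-exact (h d) (<⇒≤ depth<n))))))

      leaf-holds-one : ∀ d → subtreeCount h every (h d) ≡ 1
      leaf-holds-one d = begin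
        subtreeCount h every (h d) ≡⟨ subtree-exact (h d) (depth≤n reach d) ⟩
        k ^ (n ∸ length (h d))     ≡⟨ cong (λ l → k ^ (n ∸ l)) (chip-depth d) ⟩
        k ^ (n ∸ n)                ≡⟨ cong (k ^_) (n∸n≡0 n) ⟩
        1                          ∎
        where open ≡-Reasoning

      injective : ∀ d d′ → h d ≡ h d′ → d ≡ d′
      injective d d′ hd≡hd′ with d ≟ᶠ d′
      ... | yes d≡d′ = d≡d′
      ... | no d≢d′  = ⊥-elim (<⇒≱ (count-≥2 _ d d′ d≢d′ (dec-true (h d ≼? h d) ≼-refl)
                                                            (dec-true (h d ≼? h d′) (subst (h d ≼_) hd≡hd′ ≼-refl)))
                                   (≤-reflexive (leaf-holds-one d)))

  -- Relabelling adjacent chips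

  fire-congˡ : ∀ {h₀ h h′} → h₀ ≗ h → Fire k n h h′ → Fire k n h₀ h′
  fire-congˡ h₀≗h (v , g , g-inc , from , to , rest) =
    v , g , g-inc , (λ r → trans (h₀≗h (g r)) (from r)) , to , (λ d d∉g → trans (rest d d∉g) (sym (h₀≗h d)))

  star-moves-down : ∀ {h f} → Star (Fire k n) h f → ∀ d → h d ≼ f d
  star-moves-down ε        d = ≼-refl
  star-moves-down (F ◅ Fs) d = ≼-trans (Firing.moves-down F d) (star-moves-down Fs d)

  relabel : Permutation′ N → Config k n → Config k n
  relabel π h = h ∘ (π ⟨$⟩ʳ_)

  relabel-fire : ∀ (π : Permutation′ N) {h h′} (F : Fire k n h h′) → StrictlyIncreasing ((π ⟨$⟩ˡ_) ∘ Firing.chip F) →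
                 Fire k n (relabel π h) (relabel π h′)
  relabel-fire π {h} {h′} (v , g , _ , from , to , rest) π⁻¹g-inc =
    v , (π ⟨$⟩ˡ_) ∘ g , π⁻¹g-inc ,
    (λ r → trans (cong h (inverseʳ π)) (from r)) ,
    (λ r → trans (cong h′ (inverseʳ π)) (to r)) ,
    (λ d d∉ → rest (π ⟨$⟩ʳ d) (λ r πd≡gr → d∉ r (trans (sym (inverseˡ π)) (cong (π ⟨$⟩ˡ_) πd≡gr))))

  below : Config k n → Vertex k → Chip k n → ℕ
  below f t d = count (λ e → does (e <ᶠ? d) ∧ (t ≼ᵇ f e))

  Lands : Config k n → Vertex k → ℕ → Chip k n → Set
  Lands f t x d = t ≼ f d × suc (below f t d) ≡ x

  module Adjacent {c c′ : Chip k n} (adjacent : toℕ c′ ≡ suc (toℕ c)) where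

    σ : Permutation′ N
    σ = transpose c c′

    c≢c′ : c ≢ c′
    c≢c′ c≡c′ = 1+n≢n (sym (trans (cong toℕ c≡c′) adjacent))

    data Cases (e : Chip k n) : Set where
      is-c  : e ≡ c → Cases e
      is-c′ : e ≡ c′ → Cases e
      other : e ≢ c → e ≢ c′ → Cases e

    cases : ∀ e → Cases e
    cases e with e ≟ᶠ c | e ≟ᶠ c′
    ... | yes e≡c | _        = is-c e≡c
    ... | no _    | yes e≡c′ = is-c′ e≡c′
    ... | no e≢c  | no e≢c′  = other e≢c e≢c′

    record Swaps (τ : Chip k n → Chip k n) : Set where
      field
        at-c  : τ c ≡ c′
        at-c′ : τ c′ ≡ c
        fixes : ∀ e → e ≢ c → e ≢ c′ → τ e ≡ e

    σ-swaps : Swaps (σ ⟨$⟩ʳ_)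
    σ-swaps = record { at-c = transpose-at-i c c′ ; at-c′ = transpose-at-j c≢c′ ; fixes = λ e → transpose-other }

    σ⁻¹-swaps : Swaps (σ ⟨$⟩ˡ_)
    σ⁻¹-swaps = record
      { at-c = transpose-at-j (c≢c′ ∘ sym) ; at-c′ = transpose-at-i c′ c ; fixes = λ e e≢c e≢c′ → transpose-other e≢c′ e≢c }

    c<c′ : c <ᶠ c′
    c<c′ = ≤-reflexive (sym adjacent)

    below-c′ : ∀ {e} → e ≢ c → e <ᶠ c′ → e <ᶠ c
    below-c′ e≢c e<c′ with m≤n⇒m<n∨m≡n (≤-pred (subst (_ <_) adjacent e<c′))
    ... | inj₁ e<c = e<c
    ... | inj₂ e≡c = ⊥-elim (e≢c (toℕ-injective e≡c))

    above-c : ∀ {e} → e ≢ c′ → c <ᶠ e → c′ <ᶠ e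
    above-c e≢c′ c<e with m≤n⇒m<n∨m≡n (subst (_≤ _) (sym adjacent) c<e)
    ... | inj₁ c′<e = c′<e
    ... | inj₂ c′≡e = ⊥-elim (e≢c′ (toℕ-injective (sym c′≡e)))

    module _ {τ} (swaps : Swaps τ) where
      open Swaps swaps

      swap-increasing : ∀ e e′ → e <ᶠ e′ → ¬ (e ≡ c × e′ ≡ c′) → τ e <ᶠ τ e′
      swap-increasing e e′ e<e′ not-cc′ with cases e | cases e′
      ... | is-c refl  | is-c refl   = ⊥-elim (<-irrefl refl e<e′)
      ... | is-c refl  | is-c′ refl  = ⊥-elim (not-cc′ (refl , refl))
      ... | is-c refl  | other x y   rewrite at-c  | fixes e′ x y = above-c y e<e′
      ... | is-c′ refl | is-c refl   = ⊥-elim (<-asym e<e′ c<c′)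
      ... | is-c′ refl | is-c′ refl  = ⊥-elim (<-irrefl refl e<e′)
      ... | is-c′ refl | other x y   rewrite at-c′ | fixes e′ x y = <-trans c<c′ e<e′
      ... | other x y  | is-c refl   rewrite at-c  | fixes e x y = <-trans e<e′ c<c′
      ... | other x y  | is-c′ refl  rewrite at-c′ | fixes e x y = below-c′ x e<e′
      ... | other x y  | other x′ y′ rewrite fixes e x y | fixes e′ x′ y′ = e<e′

      swap-moves-≤1 : ∀ e → toℕ (τ e) ≤ suc (toℕ e) × toℕ e ≤ suc (toℕ (τ e))
      swap-moves-≤1 e with cases e
      ... | is-c refl  rewrite at-c  = ≤-reflexive adjacent , ≤-trans (<⇒≤ c<c′) (n≤1+n _)
      ... | is-c′ refl rewrite at-c′ = ≤-trans (<⇒≤ c<c′) (n≤1+n _) , ≤-reflexive adjacent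
      ... | other x y  rewrite fixes e x y = n≤1+n _ , n≤1+n _

    relabel-star : ∀ {h f} → Star (Fire k n) h f → ¬ (f c ◁ f c′) → Star (Fire k n) (relabel σ h) (relabel σ f)
    relabel-star ε        _        = ε
    relabel-star {f = f} (_◅_ {j = h′} F Fs) c⋪c′ = relabel-fire σ F increasing ◅ relabel-star Fs c⋪c′
      where
      open Firing F
      -- Had c and c′ been fired together, c would have ended up left of c′.
      increasing : StrictlyIncreasing ((σ ⟨$⟩ˡ_) ∘ chip)
      increasing r s r<s = swap-increasing σ⁻¹-swaps (chip r) (chip s) (chip-increasing r s r<s) λ where
        (r↦c , s↦c′) → c⋪c′ (◁-≼ (∷ʳ-◁ vertex r<s)
          (subst (_≼ f c)  (trans (cong h′ (sym r↦c)) (chip-to r))  (star-moves-down Fs c))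
          (subst (_≼ f c′) (trans (cong h′ (sym s↦c′)) (chip-to s)) (star-moves-down Fs c′)))

    relabel-stable : ∀ {f} → Stable k n f → f c ≢ f c′ → Stable k n (relabel σ f)
    relabel-stable {f} stable fc≢fc′ (f′ , F) =
      stable (relabel (flip σ) f′ , fire-congˡ (λ d → cong f (sym (inverseʳ σ))) (relabel-fire (flip σ) F increasing))
      where
      open Firing F
      open ≡-Reasoning
      increasing : StrictlyIncreasing ((σ ⟨$⟩ʳ_) ∘ chip)
      increasing r s r<s = swap-increasing σ-swaps (chip r) (chip s) (chip-increasing r s r<s) λ where
        (r↦c , s↦c′) → fc≢fc′ (begin
          f c                    ≡⟨ cong f (Swaps.at-c′ σ-swaps) ⟨
          f (σ ⟨$⟩ʳ c′)          ≡⟨ cong (f ∘ (σ ⟨$⟩ʳ_)) s↦c′ ⟨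
          f (σ ⟨$⟩ʳ chip s)      ≡⟨ chip-from s ⟩
          vertex                 ≡⟨ chip-from r ⟨
          f (σ ⟨$⟩ʳ chip r)      ≡⟨ cong (f ∘ (σ ⟨$⟩ʳ_)) r↦c ⟩
          f (σ ⟨$⟩ʳ c)           ≡⟨ cong f (Swaps.at-c σ-swaps) ⟩
          f c′                   ∎)

    LandsNearby : Config k n → Vertex k → ℕ → Chip k n → Set
    LandsNearby f t x d = Σ[ d′ ∈ Chip k n ] Lands (relabel σ f) t x d′ × toℕ d′ ≤ suc (toℕ d) × toℕ d ≤ suc (toℕ d′)

    relabel-lands-together : ∀ {f t x d} → t ≼ f c → t ≼ f c′ → Lands f t x d → LandsNearby f t x d
    relabel-lands-together {f} {t} {x} {d} t≼fc t≼fc′ (t≼fd , x≡) =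
      d , (does-true⇒ (t ≼? f (σ ⟨$⟩ʳ d)) (trans (same-subtree d) (dec-true (t ≼? f d) t≼fd)) ,
           trans (cong suc (count-cong λ e → cong (does (e <ᶠ? d) ∧_) (same-subtree e))) x≡) ,
      n≤1+n _ , n≤1+n _
      where
      same-subtree : ∀ e → t ≼ᵇ f (σ ⟨$⟩ʳ e) ≡ t ≼ᵇ f e
      same-subtree e with cases e
      ... | is-c refl  rewrite Swaps.at-c σ-swaps  = trans (dec-true (t ≼? f c′) t≼fc′) (sym (dec-true (t ≼? f c) t≼fc))
      ... | is-c′ refl rewrite Swaps.at-c′ σ-swaps = trans (dec-true (t ≼? f c) t≼fc) (sym (dec-true (t ≼? f c′) t≼fc′))
      ... | other x y  rewrite Swaps.fixes σ-swaps e x y = refl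

    relabel-lands-apart : ∀ {f t x d} → ¬ (t ≼ f c × t ≼ f c′) → Lands f t x d → LandsNearby f t x d
    relabel-lands-apart {f} {t} {x} {d} apart (t≼fd , x≡) =
      σ ⟨$⟩ˡ d , (subst (t ≼_) (cong f (sym (inverseʳ σ))) t≼fd , trans (cong suc below-same) x≡) ,
      swap-moves-≤1 σ⁻¹-swaps d
      where
      order-kept : ∀ e → t ≼ f e → σ ⟨$⟩ˡ e <ᶠ σ ⟨$⟩ˡ d ⇔ e <ᶠ d
      order-kept e t≼fe = mk⇔
        (λ lt → subst₂ _<ᶠ_ (inverseʳ σ) (inverseʳ σ) (swap-increasing σ-swaps _ _ lt λ (e↦c , d↦c′) →
          apart (subst (λ z → t ≼ f z) (trans (sym (inverseʳ σ)) (trans (cong (σ ⟨$⟩ʳ_) d↦c′) (Swaps.at-c′ σ-swaps))) t≼fd ,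
                 subst (λ z → t ≼ f z) (trans (sym (inverseʳ σ)) (trans (cong (σ ⟨$⟩ʳ_) e↦c) (Swaps.at-c σ-swaps))) t≼fe)))
        (λ lt → swap-increasing σ⁻¹-swaps e d lt λ (e≡c , d≡c′) →
          apart (subst (λ z → t ≼ f z) e≡c t≼fe , subst (λ z → t ≼ f z) d≡c′ t≼fd))
      summand : ∀ e → (does (σ ⟨$⟩ˡ e <ᶠ? σ ⟨$⟩ˡ d) ∧ (t ≼ᵇ f e)) ≡ (does (e <ᶠ? d) ∧ (t ≼ᵇ f e))
      summand e with t ≼? f e
      ... | yes t≼fe = cong (_∧ true) (does-⇔ (order-kept e t≼fe) (σ ⟨$⟩ˡ e <ᶠ? σ ⟨$⟩ˡ d) (e <ᶠ? d))
      ... | no _     = trans (∧-zeroʳ _) (sym (∧-zeroʳ _))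
      below-same : below (relabel σ f) t (σ ⟨$⟩ˡ d) ≡ below f t d
      below-same = begin
        below (relabel σ f) t (σ ⟨$⟩ˡ d)
          ≡⟨ ∑-permute _ (flip σ) ⟩
        count (λ e → does (σ ⟨$⟩ˡ e <ᶠ? σ ⟨$⟩ˡ d) ∧ (t ≼ᵇ f (σ ⟨$⟩ʳ (σ ⟨$⟩ˡ e))))
          ≡⟨ count-cong (λ e → cong (λ z → does (σ ⟨$⟩ˡ e <ᶠ? σ ⟨$⟩ˡ d) ∧ (t ≼ᵇ f z)) (inverseʳ σ)) ⟩
        count (λ e → does (σ ⟨$⟩ˡ e <ᶠ? σ ⟨$⟩ˡ d) ∧ (t ≼ᵇ f e))
          ≡⟨ count-cong summand ⟩
        below f t d ∎
        where open ≡-Reasoning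

    relabel-lands : ∀ {f t x d} → Lands f t x d → LandsNearby f t x d
    relabel-lands {f} {t} lands with t ≼? f c | t ≼? f c′
    ... | yes t≼fc | yes t≼fc′ = relabel-lands-together t≼fc t≼fc′ lands
    ... | no t⋠fc  | _         = relabel-lands-apart (t⋠fc ∘ proj₁) lands
    ... | yes _    | no t⋠fc′  = relabel-lands-apart (t⋠fc′ ∘ proj₂) lands

    relabel-violation : ∀ {f} → Reach f → Stable k n f → f c′ ◁ f c → Reach (relabel σ f) × Stable k n (relabel σ f)
    relabel-violation reach stable c′◁c = relabel-star reach (◁-asym c′◁c) , relabel-stable stable (◁⇒≢ c′◁c ∘ sym)

  -- Sorting

  Sorted : Config k n → Set
  Sorted f = ∀ c c′ → toℕ c′ ≡ suc (toℕ c) → ¬ (f c′ ◁ f c)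

  Violation : Config k n → Set
  Violation f = Σ[ c ∈ Chip k n ] Σ[ c′ ∈ Chip k n ] toℕ c′ ≡ suc (toℕ c) × f c′ ◁ f c

  sorted-or-violation : ∀ f → Sorted f ⊎ Violation f
  sorted-or-violation f with any? (λ c → any? (λ c′ → (toℕ c′ ≟ suc (toℕ c)) ×-dec (f c′ ◁? f c)))
  ... | yes (c , c′ , adjacent , c′◁c) = inj₂ (c , c′ , adjacent , c′◁c)
  ... | no no-violation                = inj₁ λ c c′ adjacent c′◁c → no-violation (c , c′ , adjacent , c′◁c)

  sortedLabel : Vertex k → ℕ → ℕ
  sortedLabel t x = rank t * k ^ (n ∸ length t) + x

  potential : Config k n → ℕ
  potential f = sum (λ e → toℕ e * rank (f e))

  module _ (2≤k : 2 ≤ k) {f} (reach : Reach f) (stable : Stable k n f) where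
    open StableReachable 2≤k reach stable

    rank<N : ∀ e → rank (f e) < N
    rank<N e = subst (λ l → rank (f e) < k ^ l) (chip-depth e) (rank< (f e))

    potential-bound : potential f ≤ N * (N * N)
    potential-bound =
      ≤-trans (sum-mono-≤ (λ e → *-mono-≤ (<⇒≤ (toℕ<n e)) (<⇒≤ (rank<N e)))) (≤-reflexive (sum-const N (N * N)))

    potential-increases : ∀ {c c′} (adjacent : toℕ c′ ≡ suc (toℕ c)) → f c′ ◁ f c →
                          potential f < potential (relabel (Adjacent.σ adjacent) f)
    potential-increases {c} {c′} adjacent c′◁c = +-cancelʳ-< (toℕ c * b + toℕ c′ * a) (potential f) (potential f′) (begin-strict
      potential f + (toℕ c * b + toℕ c′ * a)    ≡⟨ exchange ⟩
      potential f′ + (toℕ c * a + toℕ c′ * b)   <⟨ +-monoʳ-< (potential f′) (subst (λ c′ → toℕ c * a + c′ * b < toℕ c * b + c′ * a)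
                                                                                  (sym adjacent) (rearrangement (toℕ c) b<a)) ⟩
      potential f′ + (toℕ c * b + toℕ c′ * a)   ∎)
      where
      open Adjacent adjacent
      open ≤-Reasoning
      f′ = relabel σ f
      a = rank (f c)
      b = rank (f c′)
      b<a : b < a
      b<a = ◁⇒rank< (trans (chip-depth c′) (sym (chip-depth c))) c′◁c
      exchange : potential f + (toℕ c * b + toℕ c′ * a) ≡ potential f′ + (toℕ c * a + toℕ c′ * b)
      exchange = subst₂ (λ x y → potential f + (toℕ c * rank (f x) + toℕ c′ * rank (f y)) ≡ potential f′ + (toℕ c * a + toℕ c′ * b))
        (Swaps.at-c σ-swaps) (Swaps.at-c′ σ-swaps)
        (sum-update₂ c c′ c≢c′ λ e e≢c e≢c′ → cong (λ z → toℕ e * rank (f z)) (sym (Swaps.fixes σ-swaps e e≢c e≢c′)))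

    module _ (sorted : Sorted f) where

      rank-at : ℕ → ℕ
      rank-at i with i <? N
      ... | yes i<N = rank (f (fromℕ< i<N))
      ... | no _    = 0

      rank-at-chip : ∀ d → rank-at (toℕ d) ≡ rank (f d)
      rank-at-chip d with toℕ d <? N
      ... | yes d<N = cong (rank ∘ f) (fromℕ<-toℕ d d<N)
      ... | no d≮N  = ⊥-elim (d≮N (toℕ<n d))

      rank-at-increasing : ∀ i → suc i < N → rank-at i < rank-at (suc i)
      rank-at-increasing i i+1<N with i <? N | suc i <? N
      ... | no i≮N  | _           = ⊥-elim (i≮N (<-trans (n<1+n i) i+1<N))
      ... | yes _   | no i+1≮N    = ⊥-elim (i+1≮N i+1<N)
      ... | yes i<N | yes i+1<N′ with ◁-trichotomy (f e) (f e′) (trans (chip-depth e) (sym (chip-depth e′)))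
        where
        e  = fromℕ< i<N
        e′ = fromℕ< i+1<N′
      ...   | inj₁ fe≡fe′       =
        ⊥-elim (1+n≢n (trans (sym (toℕ-fromℕ< i+1<N′)) (trans (cong toℕ (sym (injective _ _ fe≡fe′))) (toℕ-fromℕ< i<N))))
      ...   | inj₂ (inj₁ fe◁fe′) = ◁⇒rank< (trans (chip-depth _) (sym (chip-depth _))) fe◁fe′
      ...   | inj₂ (inj₂ fe′◁fe) = ⊥-elim (sorted _ _ (trans (toℕ-fromℕ< i+1<N′) (cong suc (sym (toℕ-fromℕ< i<N)))) fe′◁fe)

      rank-at-bounded : ∀ i → i < N → rank-at i < N
      rank-at-bounded i i<N with i <? N
      ... | yes _   = rank<N _
      ... | no i≮N  = ⊥-elim (i≮N i<N)

      rank-identity : ∀ d → rank (f d) ≡ toℕ d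
      rank-identity d = trans (sym (rank-at-chip d)) (increasing-bounded⇒id N rank-at rank-at-increasing rank-at-bounded (toℕ d) (toℕ<n d))

      sorted-label : ∀ {t x d} → Lands f t x d → suc (toℕ d) ≡ sortedLabel t x
      sorted-label {t} {x} {d} (t≼fd , x≡) = begin
        suc (toℕ d)                     ≡⟨ cong suc (m+[n∸m]≡n base≤d) ⟨
        suc (base + (toℕ d ∸ base))     ≡⟨ +-suc base _ ⟨
        base + suc (toℕ d ∸ base)       ≡⟨ cong (λ z → base + suc z) below-interval ⟨
        base + suc (below f t d)        ≡⟨ cong (base +_) x≡ ⟩
        base + x                        ∎
        where
        open ≡-Reasoning
        K = k ^ (n ∸ length t)
        base = rank t * K
        |t|≤n : length t ≤ n
        |t|≤n = subst (length t ≤_) (chip-depth d) (length-mono t≼fd)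
        in-range : ∀ {e} → t ≼ f e → base ≤ toℕ e × toℕ e < suc (rank t) * K
        in-range {e} t≼fe = subst₂ (λ l r → rank t * k ^ (l ∸ length t) ≤ r × r < suc (rank t) * k ^ (l ∸ length t))
                              (chip-depth e) (rank-identity e) (≼⇒rank-range t≼fe)
        base≤d : base ≤ toℕ d
        base≤d = proj₁ (in-range t≼fd)
        range⇒subtree : ∀ {e} → e <ᶠ d → base ≤ toℕ e → t ≼ f e
        range⇒subtree {e} e<d base≤e = rank-range⇒≼ t (f e) (subst (length t ≤_) (sym (chip-depth e)) |t|≤n)
          (subst₂ (λ l r → rank t * k ^ (l ∸ length t) ≤ r) (sym (chip-depth e)) (sym (rank-identity e)) base≤e)
          (subst₂ (λ l r → r < suc (rank t) * k ^ (l ∸ length t)) (sym (chip-depth e)) (sym (rank-identity e))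
                  (<-trans e<d (proj₂ (in-range t≼fd))))
        summand : ∀ e → (does (e <ᶠ? d) ∧ (t ≼ᵇ f e)) ≡ (does (e <ᶠ? d) ∧ does (base ≤? toℕ e))
        summand e = by-order (e <ᶠ? d)
          where
          by-order : (e<d? : Dec (e <ᶠ d)) → (does e<d? ∧ (t ≼ᵇ f e)) ≡ (does e<d? ∧ does (base ≤? toℕ e))
          by-order (no _)    = refl
          by-order (yes e<d) = does-⇔ (mk⇔ (proj₁ ∘ in-range) (range⇒subtree e<d)) (t ≼? f e) (base ≤? toℕ e)
        below-interval : below f t d ≡ toℕ d ∸ base
        below-interval = trans (count-cong summand) (count-interval d base)

  Landable : Vertex k → ℕ → ℕ → Set
  Landable t x c = Σ[ f ∈ Config k n ] Reach f × Stable k n f × Σ[ d ∈ Chip k n ] suc (toℕ d) ≡ c × Lands f t x d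

  Between : ℕ → ℕ → ℕ → Set
  Between a c b = (a ≤ c × c ≤ b) ⊎ (b ≤ c × c ≤ a)

  between-self : ∀ {a c} → Between a c a → c ≡ a
  between-self (inj₁ (a≤c , c≤a)) = ≤-antisym c≤a a≤c
  between-self (inj₂ (a≤c , c≤a)) = ≤-antisym c≤a a≤c

  between-step : ∀ {a a′ c b} → a′ ≤ suc a → a ≤ suc a′ → c ≢ a → Between a c b → Between a′ c b
  between-step a′≤1+a _ c≢a (inj₁ (a≤c , c≤b)) = inj₁ (≤-trans a′≤1+a (≤∧≢⇒< a≤c (c≢a ∘ sym)) , c≤b)
  between-step _ a≤1+a′ c≢a (inj₂ (b≤c , c≤a)) = inj₂ (b≤c , ≤-pred (≤-trans (≤∧≢⇒< c≤a c≢a) a≤1+a′))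

  module _ (2≤k : 2 ≤ k) where

    potential-room : Config k n → ℕ
    potential-room f = N * (N * N) ∸ potential f

    -- Each swap moves the label at (t , x) by at most one, so no label between the current and the
    -- sorted one is skipped; each swap also increases the bounded potential.
    slide : ∀ {t x} f → Acc _<_ (potential-room f) → Reach f → Stable k n f → ∀ d → Lands f t x d →
            ∀ c → Between (suc (toℕ d)) c (sortedLabel t x) → Landable t x c
    slide f (acc smaller) reach stable d lands c between with c ≟ suc (toℕ d)
    ... | yes refl = f , reach , stable , d , refl , lands
    ... | no c≢ with sorted-or-violation f
    ...   | inj₁ sorted =
      ⊥-elim (c≢ (between-self (subst (Between _ c) (sym (sorted-label 2≤k reach stable sorted lands)) between)))
    ...   | inj₂ (c₀ , c₀′ , adjacent , violation) =
      slide f′ (smaller decreasing) reach′ stable′ d′ lands′ c (between-step (s≤s d′≤1+d) (s≤s d≤1+d′) c≢ between)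
      where
      open Adjacent adjacent
      f′ = relabel σ f
      reach′ = proj₁ (relabel-violation reach stable violation)
      stable′ = proj₂ (relabel-violation reach stable violation)
      d′ = proj₁ (relabel-lands lands)
      lands′ = proj₁ (proj₂ (relabel-lands lands))
      d′≤1+d = proj₁ (proj₂ (proj₂ (relabel-lands lands)))
      d≤1+d′ = proj₂ (proj₂ (proj₂ (relabel-lands lands)))
      decreasing : potential-room f′ < potential-room f
      decreasing = ∸-monoʳ-< (potential-increases 2≤k reach stable adjacent violation) (potential-bound 2≤k reach′ stable′)

    interval : ∀ {t x c₁ c₂ c} → Landable t x c₁ → Landable t x c₂ → c₁ ≤ c → c ≤ c₂ → Landable t x c
    interval {t} {x} {c = c} (f₁ , reach₁ , stable₁ , d₁ , refl , lands₁) (f₂ , reach₂ , stable₂ , d₂ , refl , lands₂) c₁≤c c≤c₂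
      with c ≤? sortedLabel t x
    ... | yes c≤L = slide f₁ (<-wellFounded _) reach₁ stable₁ d₁ lands₁ c (inj₁ (c₁≤c , c≤L))
    ... | no c≰L  = slide f₂ (<-wellFounded _) reach₂ stable₂ d₂ lands₂ c (inj₂ (<⇒≤ (≰⇒> c≰L) , c≤c₂))

  -- Explicit strategies

  infix 4 _⇝_

  _⇝_ : Config k n → Config k n → Set
  h ⇝ h′ = Σ[ f ∈ Config k n ] Star (Fire k n) h f × f ≗ h′

  star-congˡ : ∀ {h₀ h f} → h₀ ≗ h → Star (Fire k n) h f → Σ[ f₀ ∈ Config k n ] Star (Fire k n) h₀ f₀ × f₀ ≗ f
  star-congˡ {h₀} h₀≗h ε        = h₀ , ε , h₀≗h
  star-congˡ {f = f} h₀≗h (F ◅ Fs) = f , fire-congˡ h₀≗h F ◅ Fs , λ _ → refl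

  ⇝-reflexive : ∀ {h h′} → h ≗ h′ → h ⇝ h′
  ⇝-reflexive {h} h≗h′ = h , ε , h≗h′

  ⇝-trans : ∀ {h h′ h″} → h ⇝ h′ → h′ ⇝ h″ → h ⇝ h″
  ⇝-trans (f , h↝f , f≗h′) (g , h′↝g , g≗h″) with star-congˡ f≗h′ h′↝g
  ... | g₀ , f↝g₀ , g₀≗g = g₀ , h↝f ◅◅ f↝g₀ , λ d → trans (g₀≗g d) (g≗h″ d)

  fire-⇝ : ∀ {h h′} → Fire k n h h′ → h ⇝ h′
  fire-⇝ {h′ = h′} F = h′ , F ◅ ε , λ _ → refl

  OrderEmbedding : ℕ → (ℕ → Chip k n) → Set
  OrderEmbedding M emb = ∀ {i j} → i < j → j < M → emb i <ᶠ emb j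

  embedding-injective : ∀ {M emb} → OrderEmbedding M emb → ∀ {i j} → i < M → j < M → emb i ≡ emb j → i ≡ j
  embedding-injective emb-mono {i} {j} i<M j<M emb≡ with <-cmp i j
  ... | tri< i<j _ _ = ⊥-elim (<-irrefl (cong toℕ emb≡) (emb-mono i<j j<M))
  ... | tri≈ _ i≡j _ = i≡j
  ... | tri> _ _ j<i = ⊥-elim (<-irrefl (cong toℕ (sym emb≡)) (emb-mono j<i i<M))

  preimage? : ∀ M (emb : ℕ → Chip k n) d → (Σ[ i ∈ ℕ ] i < M × emb i ≡ d) ⊎ (∀ i → i < M → emb i ≢ d)
  preimage? M emb d with any? (λ (i : Fin M) → emb (toℕ i) ≟ᶠ d)
  ... | yes (i , emb≡d) = inj₁ (toℕ i , toℕ<n i , emb≡d)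
  ... | no none        = inj₂ λ i i<M emb≡d → none (fromℕ< i<M , trans (cong emb (toℕ-fromℕ< i<M)) emb≡d)

  place : Config k n → (ℕ → Chip k n) → ℕ → (ℕ → Vertex k) → Config k n
  place h emb M to d with preimage? M emb d
  ... | inj₁ (i , _) = to i
  ... | inj₂ _       = h d

  place-image : ∀ {M emb} h to → OrderEmbedding M emb → ∀ {i} → i < M → place h emb M to (emb i) ≡ to i
  place-image {M} {emb} h to emb-mono {i} i<M with preimage? M emb (emb i)
  ... | inj₁ (i′ , i′<M , emb≡) = cong to (embedding-injective emb-mono i′<M i<M emb≡)
  ... | inj₂ none               = ⊥-elim (none i i<M refl)

  place-outside : ∀ {M emb} h to d → (∀ i → i < M → emb i ≢ d) → place h emb M to d ≡ h d
  place-outside {M} {emb} h to d outside with preimage? M emb d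
  ... | inj₁ (i , i<M , emb≡d) = ⊥-elim (outside i i<M emb≡d)
  ... | inj₂ _                 = refl

  place-cong : ∀ {M emb} h h′ to to′ → (∀ i → i < M → to i ≡ to′ i) →
               (∀ d → (∀ i → i < M → emb i ≢ d) → h d ≡ h′ d) → place h emb M to ≗ place h′ emb M to′
  place-cong {M} {emb} h h′ to to′ to≡ h≡ d with preimage? M emb d
  ... | inj₁ (i , i<M , refl) = to≡ i i<M
  ... | inj₂ outside          = h≡ d outside

  place-id : ∀ {M emb} h to → (∀ i → i < M → to i ≡ h (emb i)) → place h emb M to ≗ h
  place-id {M} {emb} h to to≡ d with preimage? M emb d
  ... | inj₁ (i , i<M , refl) = to≡ i i<M
  ... | inj₂ _                = refl

  module Construction (2≤k : 2 ≤ k) where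

    fin : ℕ → Fin k
    fin = toFin (0<k 2≤k)

    dealingFor : Fin (suc k) → (K : ℕ) → Dealing k K
    dealingFor u K = SplitDealing.dealing k (toℕ u) K (≤-pred (toℕ<n u))

    -- The leaf of the i-th chip when every vertex on layer ℓ deals with split point us_ℓ.
    leaf : List (Fin (suc k)) → ℕ → Vertex k
    leaf []       i = []
    leaf (u ∷ us) i = fin (child i) ∷ leaf us (round i)
      where open Dealing (dealingFor u (k ^ length us))

    -- All K rounds are fired at v, then each child deals its share recursively.
    deal-all : ∀ us emb → OrderEmbedding (k ^ length us) emb → ∀ v h → (∀ i → i < k ^ length us → h (emb i) ≡ v) →
               h ⇝ place h emb (k ^ length us) (λ i → v ++ leaf us i)
    deal-all []       emb emb-mono v h at-v =
      ⇝-reflexive λ d → sym (place-id h (λ i → v ++ []) (λ i i<1 → trans (++-identityʳ v) (sym (at-v i i<1))) d)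
    deal-all (u ∷ us) emb emb-mono v h at-v =
      ⇝-trans (⇝-reflexive (sym ∘ dealt-0)) (⇝-trans (deal-rounds K ≤-refl)
        (⇝-trans (⇝-reflexive dealt-K) (⇝-trans (spread-children k ≤-refl) (⇝-reflexive spread-k))))
      where
      K = k ^ length us
      M = k * K
      open Dealing (dealingFor u K)

      dealt : ℕ → Config k n
      dealt q = place h emb M (λ i → if does (round i <? q) then v ∷ʳ fin (child i) else v)

      spread : ℕ → Config k n
      spread r₀ = place h emb M (λ i → if does (child i <? r₀) then v ++ fin (child i) ∷ leaf us (round i) else v ∷ʳ fin (child i))

      dealt-0 : dealt 0 ≗ h
      dealt-0 = place-id {M} h _ (λ i i<M → sym (at-v i i<M))

      round-firing : ∀ q → q < K → Fire k n (dealt q) (dealt (suc q))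
      round-firing q q<K = v , chip , chip-increasing , from , to , rest
        where
        chip : Fin k → Chip k n
        chip r = emb (deal q (toℕ r))
        dealt-chip< : ∀ r → deal q (toℕ r) < M
        dealt-chip< r = deal< q<K (toℕ<n r)
        chip-increasing : StrictlyIncreasing chip
        chip-increasing r s r<s = emb-mono (deal-monoʳ q<K r<s (toℕ<n s)) (dealt-chip< s)
        from : ∀ r → dealt q (chip r) ≡ v
        from r = trans (place-image h _ emb-mono (dealt-chip< r))
                       (if-no (round (deal q (toℕ r)) <? q) (<-irrefl (round-deal q<K (toℕ<n r))))
        to : ∀ r → dealt (suc q) (chip r) ≡ v ∷ʳ r
        to r = trans (place-image h _ emb-mono (dealt-chip< r)) (trans
                 (if-yes (round (deal q (toℕ r)) <? suc q) (≤-reflexive (cong suc (round-deal q<K (toℕ<n r)))))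
                 (trans (cong (λ c → v ∷ʳ fin c) (child-deal q<K (toℕ<n r))) (cong (v ∷ʳ_) (toFin-toℕ (0<k 2≤k) r))))
        rest : ∀ d → (∀ r → d ≢ chip r) → dealt (suc q) d ≡ dealt q d
        rest d not-fired with preimage? M emb d
        ... | inj₂ _                = refl
        ... | inj₁ (i , i<M , refl) = if-⇔ (mk⇔ (λ lt → ≤∧≢⇒< (≤-pred lt) other-round) (m<n⇒m<1+n)) (round i <? suc q) (round i <? q)
          where
          other-round : round i ≢ q
          other-round refl = not-fired (fin (child i)) (cong emb (trans (sym (deal-round-child i<M))
                                                        (cong (deal (round i)) (sym (toℕ-toFin (0<k 2≤k) (child< i<M))))))

      deal-rounds : ∀ q → q ≤ K → dealt 0 ⇝ dealt q
      deal-rounds zero    _    = ⇝-reflexive λ _ → refl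
      deal-rounds (suc q) q<K = ⇝-trans (deal-rounds q (<⇒≤ q<K)) (fire-⇝ (round-firing q q<K))

      dealt-K : dealt K ≗ spread 0
      dealt-K = place-cong {M} h h _ _ (λ i i<M → if-yes (round i <? K) (round< i<M)) (λ _ _ → refl)

      spread-child : ∀ r₀ → r₀ < k → spread r₀ ⇝ spread (suc r₀)
      spread-child r₀ r₀<k = ⇝-trans (deal-all us emb′ emb′-mono (v ∷ʳ fin r₀) (spread r₀) at-child) (⇝-reflexive settled)
        where
        emb′ : ℕ → Chip k n
        emb′ j = emb (deal j r₀)
        emb′-mono : OrderEmbedding K emb′
        emb′-mono j<j′ j′<K = emb-mono (deal-monoˡ j<j′ j′<K r₀<k) (deal< j′<K r₀<k)
        at-child : ∀ j → j < K → spread r₀ (emb′ j) ≡ v ∷ʳ fin r₀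
        at-child j j<K = trans (place-image h _ emb-mono (deal< j<K r₀<k)) (trans
          (if-no (child (deal j r₀) <? r₀) (<-irrefl (child-deal j<K r₀<k))) (cong (λ c → v ∷ʳ fin c) (child-deal j<K r₀<k)))
        settled : place (spread r₀) emb′ K (λ j → (v ∷ʳ fin r₀) ++ leaf us j) ≗ spread (suc r₀)
        settled d with preimage? M emb d
        ... | inj₂ outside = trans (place-outside (spread r₀) _ d λ j j<K → outside _ (deal< j<K r₀<k))
                                   (place-outside h _ d outside)
        ... | inj₁ (i , i<M , refl) with child i ≟ r₀
        ...   | yes refl = trans (cong (place (spread r₀) emb′ K _) (cong emb (sym (deal-round-child i<M))))
                             (trans (place-image (spread r₀) _ emb′-mono (round< i<M))
                               (trans (++-assoc v [ fin (child i) ] _) (sym (if-yes (child i <? suc (child i)) ≤-refl))))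
        ...   | no other = trans (place-outside (spread r₀) _ (emb i) not-here)
                             (trans (place-image h _ emb-mono i<M)
                               (if-⇔ (mk⇔ m<n⇒m<1+n λ lt → ≤∧≢⇒< (≤-pred lt) other) (child i <? r₀) (child i <? suc r₀)))
          where
          not-here : ∀ j → j < K → emb′ j ≢ emb i
          not-here j j<K emb′≡ =
            other (trans (cong child (sym (embedding-injective emb-mono (deal< j<K r₀<k) i<M emb′≡))) (child-deal j<K r₀<k))

      spread-children : ∀ r₀ → r₀ ≤ k → spread 0 ⇝ spread r₀
      spread-children zero     _    = ⇝-reflexive λ _ → refl
      spread-children (suc r₀) r₀<k = ⇝-trans (spread-children r₀ (<⇒≤ r₀<k)) (spread-child r₀ r₀<k)

      spread-k : spread k ≗ place h emb M (λ i → v ++ leaf (u ∷ us) i)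
      spread-k = place-cong h h _ _ (λ i i<M → if-yes (child i <? k) (child< i<M)) (λ _ _ → refl)

    leaf-length : ∀ us i → length (leaf us i) ≡ length us
    leaf-length []       i = refl
    leaf-length (u ∷ us) i = cong suc (leaf-length us _)

    leaf-injective : ∀ us {i i′} → i < k ^ length us → i′ < k ^ length us → leaf us i ≡ leaf us i′ → i ≡ i′
    leaf-injective []       (s≤s z≤n) (s≤s z≤n) _ = refl
    leaf-injective (u ∷ us) {i} {i′} i<M i′<M leaf≡ with ∷-injective leaf≡
    ... | child≡ , rest≡ = begin
      i                              ≡⟨ deal-round-child i<M ⟨
      deal (round i) (child i)       ≡⟨ cong₂ deal (leaf-injective us (round< i<M) (round< i′<M) rest≡) (begin
        child i                        ≡⟨ toℕ-toFin (0<k 2≤k) (child< i<M) ⟨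
        toℕ (fin (child i))            ≡⟨ cong toℕ child≡ ⟩
        toℕ (fin (child i′))           ≡⟨ toℕ-toFin (0<k 2≤k) (child< i′<M) ⟩
        child i′                       ∎) ⟩
      deal (round i′) (child i′)     ≡⟨ deal-round-child i′<M ⟩
      i′                             ∎
      where
      open Dealing (dealingFor u (k ^ length us))
      open ≡-Reasoning

    index : List (Fin (suc k)) → Vertex k → ℕ
    index []       _       = 0
    index (_ ∷ _)  []      = 0
    index (u ∷ us) (s ∷ t) = Dealing.deal (dealingFor u (k ^ length us)) (index us t) (toℕ s)

    index-leaf : ∀ us t → length t ≡ length us → index us t < k ^ length us × leaf us (index us t) ≡ t
    index-leaf []       []      _     = s≤s z≤n , refl
    index-leaf (u ∷ us) (s ∷ t) |t|≡ with index-leaf us t (suc-injective |t|≡)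
    ... | index< , leaf≡ = deal< index< (toℕ<n s) ,
      cong₂ _∷_ (trans (cong fin (child-deal index< (toℕ<n s))) (toFin-toℕ (0<k 2≤k) s))
                (trans (cong (leaf us) (round-deal index< (toℕ<n s))) leaf≡)
      where open Dealing (dealingFor u (k ^ length us))

    injective⇒stable : ∀ {f} → (∀ e e′ → f e ≡ f e′ → e ≡ e′) → Stable k n f
    injective⇒stable f-injective (_ , F) =
      <-irrefl (cong toℕ (f-injective _ _ (trans (chip-from r₀) (sym (chip-from r₁))))) (chip-increasing r₀ r₁ r₀<r₁)
      where
      open Firing F
      r₀ r₁ : Fin k
      r₀ = fromℕ< (0<k 2≤k)
      r₁ = fromℕ< 2≤k
      r₀<r₁ : r₀ <ᶠ r₁
      r₀<r₁ = subst₂ _<_ (sym (toℕ-fromℕ< (0<k 2≤k))) (sym (toℕ-fromℕ< 2≤k)) (s≤s z≤n)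

    leaf-lands : ∀ {f} d → (∀ e e′ → f e ≡ f e′ → e ≡ e′) → (∀ e → length (f e) ≡ length (f d)) → Lands f (f d) 1 d
    leaf-lands {f} d f-injective same-depth = ≼-refl , cong suc (count-none _ nothing-below)
      where
      nothing-below : ∀ e → (does (e <ᶠ? d) ∧ (f d ≼ᵇ f e)) ≡ false
      nothing-below e with f d ≼? f e
      ... | no _     = ∧-zeroʳ _
      ... | yes fd≼fe = trans (∧-identityʳ _) (dec-false (e <ᶠ? d) λ e<d →
                          <-irrefl (cong toℕ (f-injective e d (sym (≼-≡ fd≼fe (≤-reflexive (same-depth e)))))) e<d)

    0<N : 0 < N
    0<N = m^n>0 k {{>-nonZero (0<k 2≤k)}} n

    identity-embedding : OrderEmbedding N (toFin 0<N)
    identity-embedding {i} {j} i<j j<N = subst₂ _<_ (sym (toℕ-toFin 0<N (<-trans i<j j<N))) (sym (toℕ-toFin 0<N j<N)) i<j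

    deal-everything : ∀ us → length us ≡ n → Σ[ f ∈ Config k n ] Reach f × ∀ d → f d ≡ leaf us (toℕ d)
    deal-everything us |us|≡n with deal-all us (toFin 0<N) embedding [] (initial k n) (λ _ _ → refl)
      where
      embedding : OrderEmbedding (k ^ length us) (toFin 0<N)
      embedding = subst (λ M → OrderEmbedding M (toFin 0<N)) (cong (k ^_) (sym |us|≡n)) identity-embedding
    ... | f , reach , f≗ = f , reach , λ d → trans (f≗ d) (begin
      place (initial k n) (toFin 0<N) (k ^ length us) (leaf us) d            ≡⟨ cong (λ M → place (initial k n) (toFin 0<N) (k ^ M) (leaf us) d) |us|≡n ⟩
      place (initial k n) (toFin 0<N) N (leaf us) d                          ≡⟨ cong (place (initial k n) (toFin 0<N) N (leaf us)) (toFin-toℕ 0<N d) ⟨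
      place (initial k n) (toFin 0<N) N (leaf us) (toFin 0<N (toℕ d))        ≡⟨ place-image (initial k n) (leaf us) identity-embedding (toℕ<n d) ⟩
      leaf us (toℕ d)                                                        ∎)
      where open ≡-Reasoning

    landable-index : ∀ us t → length us ≡ n → length t ≡ n → Landable t 1 (suc (index us t))
    landable-index us t |us|≡n |t|≡n with deal-everything us |us|≡n
    ... | f , reach , f≡leaf = f , reach , injective⇒stable f-injective , d , cong suc (toℕ-fromℕ< index<N) ,
                               subst (λ u → Lands f u 1 d) fd≡t (leaf-lands d f-injective same-depth)
      where
      index<N : index us t < N
      index<N = subst (λ l → index us t < k ^ l) |us|≡n (proj₁ (index-leaf us t (trans |t|≡n (sym |us|≡n))))
      d : Chip k n
      d = fromℕ< index<N
      fd≡t : f d ≡ t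
      fd≡t = trans (f≡leaf d) (trans (cong (leaf us) (toℕ-fromℕ< index<N)) (proj₂ (index-leaf us t (trans |t|≡n (sym |us|≡n)))))
      below-M : ∀ (e : Chip k n) → toℕ e < k ^ length us
      below-M e = subst (λ l → toℕ e < k ^ l) (sym |us|≡n) (toℕ<n e)
      f-injective : ∀ e e′ → f e ≡ f e′ → e ≡ e′
      f-injective e e′ fe≡fe′ = toℕ-injective (leaf-injective us (below-M e) (below-M e′) (trans (sym (f≡leaf e)) (trans fe≡fe′ (f≡leaf e′))))
      same-depth : ∀ e → length (f e) ≡ length (f d)
      same-depth e = trans (cong length (f≡leaf e)) (trans (leaf-length us _) (sym (trans (cong length (f≡leaf d)) (leaf-length us _))))

    index-lowest : ∀ t → suc (index (map Fin.suc t) t) ≡ prodT t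
    index-lowest []      = refl
    index-lowest (s ∷ t) = begin
      suc (deal (index (map Fin.suc t) t) (toℕ s))               ≡⟨ cong suc (deal-low (index (map Fin.suc t) t) (n<1+n (toℕ s))) ⟩
      suc (index (map Fin.suc t) t * suc (toℕ s) + toℕ s)        ≡⟨ regroup (index (map Fin.suc t) t) (toℕ s) ⟩
      suc (toℕ s) * suc (index (map Fin.suc t) t)                ≡⟨ cong (suc (toℕ s) *_) (index-lowest t) ⟩
      suc (toℕ s) * prodT t                                  ∎
      where
      open SplitDealing k (suc (toℕ s)) (k ^ length (map Fin.suc t)) (≤-pred (toℕ<n (Fin.suc s))) using (deal; deal-low)
      open ≡-Reasoning
      regroup : ∀ j s → suc (j * suc s + s) ≡ suc s * suc j
      regroup = solve-∀

    index-highest : ∀ t → index (map inject₁ t) t + prodK k t ≡ k ^ length t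
    index-highest []      = refl
    index-highest (s ∷ t) = begin
      deal j (toℕ s) + w * p                                 ≡⟨ cong (_+ w * p) (deal-high j (<-irrefl (sym (toℕ-inject₁ s)))) ⟩
      u * K + (j * (k ∸ u) + (toℕ s ∸ u)) + w * p            ≡⟨ cong (λ u → u * K + (j * (k ∸ u) + (toℕ s ∸ u)) + w * p) (toℕ-inject₁ s) ⟩
      toℕ s * K + (j * w + (toℕ s ∸ toℕ s)) + w * p          ≡⟨ cong (λ z → toℕ s * K + (j * w + z) + w * p) (n∸n≡0 (toℕ s)) ⟩
      toℕ s * K + (j * w + 0) + w * p                        ≡⟨ regroup (toℕ s) K j w p ⟩
      toℕ s * K + w * (j + p)                                ≡⟨ cong (λ x → toℕ s * K + w * x) (trans (index-highest t) (sym K≡)) ⟩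
      toℕ s * K + w * K                                      ≡⟨ *-distribʳ-+ K (toℕ s) w ⟨
      (toℕ s + w) * K                                        ≡⟨ cong₂ _*_ (m+[n∸m]≡n (<⇒≤ (toℕ<n s))) K≡ ⟩
      k * k ^ length t                                       ∎
      where
      u = toℕ (inject₁ s)
      K = k ^ length (map inject₁ t)
      j = index (map inject₁ t) t
      w = k ∸ toℕ s
      p = prodK k t
      open SplitDealing k u K (≤-pred (toℕ<n (inject₁ s))) using (deal; deal-high)
      open ≡-Reasoning
      K≡ : K ≡ k ^ length t
      K≡ = cong (k ^_) (length-map inject₁ t)
      regroup : ∀ a K j w p → a * K + (j * w + 0) + w * p ≡ a * K + w * (j + p)
      regroup = solve-∀

    landable-lowest : ∀ t → length t ≡ n → Landable t 1 (prodT t)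
    landable-lowest t |t|≡n =
      subst (Landable t 1) (index-lowest t) (landable-index (map Fin.suc t) t (trans (length-map Fin.suc t) |t|≡n) |t|≡n)

    landable-highest : ∀ t → length t ≡ n → Landable t 1 (N + 1 ∸ prodK k t)
    landable-highest t |t|≡n = subst (Landable t 1) label≡ (landable-index (map inject₁ t) t (trans (length-map inject₁ t) |t|≡n) |t|≡n)
      where
      j = index (map inject₁ t) t
      label≡ : suc j ≡ N + 1 ∸ prodK k t
      label≡ = begin
        suc j                           ≡⟨ m+n∸n≡m (suc j) (prodK k t) ⟨
        suc j + prodK k t ∸ prodK k t   ≡⟨ cong (λ m → suc m ∸ prodK k t) (trans (index-highest t) (cong (k ^_) |t|≡n)) ⟩
        suc N ∸ prodK k t               ≡⟨ cong (_∸ prodK k t) (+-comm 1 N) ⟩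
        N + 1 ∸ prodK k t               ∎
        where open ≡-Reasoning

  label≤N+1∸prodK : ∀ {f} → Reach f → ∀ t d → t ≼ f d → suc (toℕ d) ≤ N + 1 ∸ prodK k t
  label≤N+1∸prodK reach t d t≼fd = m+n≤o⇒m≤o∸n (suc (toℕ d)) (subst (suc (toℕ d) + prodK k t ≤_) (+-comm 1 N)
    (s≤s (subst (_≤ N) (+-comm (prodK k t) (toℕ d)) (m≤o∸n⇒m+n≤o (prodK k t) (<⇒≤ (toℕ<n d)) (prodK≤chips-from reach t d t≼fd)))))

  countBelow≡below : ∀ f t d → countBelow k n f t d ≡ below f t d
  countBelow≡below f t d = length-filter-tabulate (λ e → (e <ᶠ? d) ×-dec (t ≼? f e)) (λ e → e)

  canLand⇒landable : ∀ {t x c} → CanLand k n t x c → Landable t x c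
  canLand⇒landable (d , label , f , reach , stable , t≼fd , x≡) =
    f , reach , stable , d , label , t≼fd , trans (cong suc (sym (countBelow≡below f _ d))) x≡

  landable⇒canLand : ∀ {t x c} → Landable t x c → CanLand k n t x c
  landable⇒canLand (f , reach , stable , d , label , t≼fd , x≡) =
    d , label , f , reach , stable , t≼fd , trans (cong suc (countBelow≡below f _ d)) x≡

  canLand-lower : ∀ {t x c} → CanLand k n t x c → prodT t ≤ c
  canLand-lower {t} (d , refl , f , reach , _ , t≼fd , _) = prodT≤label reach t d t≼fd

  canLand-upper : ∀ {t x c} → CanLand k n t x c → c ≤ N + 1 ∸ prodK k t
  canLand-upper {t} (d , refl , f , reach , _ , t≼fd , _) = label≤N+1∸prodK reach t d t≼fd

  module _ (2≤k : 2 ≤ k) where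
    open Construction 2≤k

    canLand-interval : ∀ {t x a b c} → IsA k n t x a → IsB k n t x b → a ≤ c → c ≤ b → CanLand k n t x c
    canLand-interval (a-lands , _) (b-lands , _) a≤c c≤b =
      landable⇒canLand (interval 2≤k (canLand⇒landable a-lands) (canLand⇒landable b-lands) a≤c c≤b)

    leaf-isA : ∀ {t} → length t ≡ n → IsA k n t 1 (prodT t)
    leaf-isA {t} |t|≡n = landable⇒canLand (landable-lowest t |t|≡n) , λ _ → canLand-lower

    leaf-isB : ∀ {t} → length t ≡ n → IsB k n t 1 (N + 1 ∸ prodK k t)
    leaf-isB {t} |t|≡n = landable⇒canLand (landable-highest t |t|≡n) , λ _ → canLand-upper

    canEndAt⇔ : ∀ {t} → length t ≡ n → ∀ c → CanEndAt k n t c ⇔ (prodT t ≤ c × c ≤ N + 1 ∸ prodK k t)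
    canEndAt⇔ {t} |t|≡n c = mk⇔
      (λ { (d , refl , f , reach , _ , fd≡t) → let t≼fd = subst (t ≼_) (sym fd≡t) ≼-refl in
             prodT≤label reach t d t≼fd , label≤N+1∸prodK reach t d t≼fd })
      (λ (lower , upper) → ends-at (interval 2≤k (landable-lowest t |t|≡n) (landable-highest t |t|≡n) lower upper))
      where
      ends-at : Landable t 1 c → CanEndAt k n t c
      ends-at (f , reach , stable , d , label , t≼fd , _) =
        d , label , f , reach , stable , sym (≼-≡ t≼fd (≤-reflexive (trans (StableReachable.chip-depth 2≤k reach stable d) (sym |t|≡n))))

theorem6p2 : (k n : ℕ) → 2 ≤ k → 1 ≤ n →
    (∀ (t : Vertex k) (x : ℕ) → 1 ≤ length t → length t ≤ n → 1 ≤ x → x ≤ k ^ (n ∸ length t) →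
      ∀ a b → IsA k n t x a → IsB k n t x b →
      ∀ c → a ≤ c → c ≤ b → CanLand k n t x c)
    × (∀ (t : Vertex k) → length t ≡ n →
      IsA k n t 1 (prodT t) × IsB k n t 1 (k ^ n + 1 ∸ prodK k t)
      × (∀ c → CanEndAt k n t c ⇔ (prodT t ≤ c × c ≤ k ^ n + 1 ∸ prodK k t)))
theorem6p2 k n 2≤k _ =
  (λ t x _ _ _ _ a b isA isB c → canLand-interval 2≤k isA isB) ,
  (λ t |t|≡n → leaf-isA 2≤k |t|≡n , leaf-isB 2≤k |t|≡n , canEndAt⇔ 2≤k |t|≡n)
  where open Game k n
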